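{- Let $K$ be a unital commutative $\mathbb{Q}$-algebra, $\alpha\ge1$ and $\emptyset\ne W\subseteq\mathbb{N}^+$. For every $T\in\mathbb{T}^W$ there exist $n\ge1$ and $F_t(z)=z-H_t(z)\in\mathbb{B}_t^{[\alpha]}\langle z\rangle$ with $H_t(z)=\sum_{m\in W}t^mH_{[m]}(z)$ such that $P_T(z)\ne0$ and $P_{T'}(z)=0$ for every $T'\in\mathbb{T}^W$ with $|T'|\ge|T|$ and $T'\not\cong T$.
   Context: $z=(z_1,\dots,z_n)$ free variables, all commutative or all noncommutative; $t$ central. $\mathbb{B}_t^{[\alpha]}\langle z\rangle$: automorphisms $F_t=z-H_t$ of $K[t]\langle z\rangle$ over $K[t]$ with $H_{t=0}=0$, $H_t$ homogeneous in $z$ of some degree $d\ge\alpha$, and $JH_t$ strictly lower triangular after a suitable permutation of the variables. $[u\,\partial/\partial z]$ is the $K$-derivation $z_i\mapsto u_i$. Trees: $W$-labeled rooted trees (vertices labeled in $W$), $\mathbb{T}^W$ the nonempty ones up to root- and label-preserving isomorphism, $|T|$ the sum of labels. $P_T$ (depending on $F_t$; $T$ with root labeled $m$): $P_T=H_{[m]}$ if $T$ is a single vertex, otherwise $P_T=B_+([P_{T_1}\partial/\partial z],\dots,[P_{T_d}\partial/\partial z])H_{[m]}$ (componentwise), $T_1,\dots,T_d$ the subtrees at the children of the root, where for $\delta_i=[v_i(z)\partial/\partial z]$, $B_+(\delta_1,\dots,\delta_k)u(z):=[v_1(w)\partial/\partial z]\cdots[v_k(w)\partial/\partial z]u(z)|_{w=z}$,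 with new free variables $w=(w_1,\dots,w_n)$ and $[v(w)\partial/\partial z]$ the derivation $z_i\mapsto v_i(w)$, $w_j\mapsto0$. -}

module Defs where

open import Level using (Level; _⊔_) renaming (suc to lsuc)
open import Data.Bool using (Bool; true; false)
open import Data.Nat as ℕ using (ℕ; zero; suc; _≤_; _<_; _<?_; _≟_; _∸_)
open import Data.Nat.Properties using () renaming (_≟_ to _≟ℕ_)
open import Data.Fin as Fin using (Fin; toℕ; fromℕ<)
open import Data.Fin.Permutation using (Permutation′; _⟨$⟩ʳ_)
open import Data.Product using (Σ; ∃; _×_; _,_)
open import Data.List as List using (List; []; _∷_; _++_; map; concatMap; foldr; length)
open import Data.List.Properties using (≡-dec)
open import Data.List.Relation.Unary.All using (All)
open import Data.List.Relation.Unary.Any using (Any)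
open import Data.List.Relation.Binary.Pointwise using (Pointwise)
open import Data.List.Relation.Binary.Permutation.Propositional using (_↭_)
open import Relation.Nullary using (¬_; yes; no)
open import Relation.Binary.PropositionalEquality using (_≡_; _≢_)
open import Algebra.Bundles using (CommutativeRing)
open import Algebra.Morphism.Structures using (module RingMorphisms)
import Data.Rational.Properties as ℚP

data Tree : Set where
  node : ℕ → List Tree → Tree

data _≅_ : Tree → Tree → Set where
  iso : ∀ {m ts ts′ us} → ts ↭ ts′ → Pointwise _≅_ ts′ us → node m ts ≅ node m us

data LabelsIn (W : ℕ → Set) : Tree → Set where
  node : ∀ {m ts} → W m → All (LabelsIn W) ts → LabelsIn W (node m ts)

mutual
  weight : Tree → ℕ
  weight (node m ts) = m ℕ.+ weights ts

  weights : List Tree → ℕ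
  weights [] = 0
  weights (t ∷ ts) = weight t ℕ.+ weights ts

IsℚAlgebra : ∀ {c ℓ} → CommutativeRing c ℓ → Set (c ⊔ ℓ)
IsℚAlgebra K = Σ (_ → CommutativeRing.Carrier K) λ f →
  RingMorphisms.IsRingHomomorphism ℚP.+-*-rawRing (CommutativeRing.rawRing K) f

-- Polynomials in K[t]⟨x₀, x₁, …⟩, t central.
-- A monomial is (a , w) = t^a · x_{w₀} x_{w₁} ⋯ (w a word of variable indices).
-- A polynomial is a finite formal sum (list) of coefficient–monomial pairs.
-- The flag b : Bool chooses the setting: false = noncommuting variables,
-- true = commuting variables (words are then compared after sorting).

insertℕ : ℕ → List ℕ → List ℕ
insertℕ x [] = x ∷ []
insertℕ x (y ∷ ys) with x ℕ.≤? y
... | yes _ = x ∷ y ∷ ys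
... | no _ = y ∷ insertℕ x ys

sortℕ : List ℕ → List ℕ
sortℕ = foldr insertℕ []

normW : Bool → List ℕ → List ℕ
normW false w = w
normW true w = sortℕ w

Mono : Set
Mono = ℕ × List ℕ

module Poly {c ℓ} (K : CommutativeRing c ℓ) (b : Bool) where
  open CommutativeRing K

  Pol : Set c
  Pol = List (Carrier × Mono)

  coeff : Pol → ℕ → List ℕ → Carrier
  coeff [] a u = 0#
  coeff ((k , (e , w)) ∷ p) a u with e ≟ℕ a | ≡-dec _≟ℕ_ (normW b w) u
  ... | yes _ | yes _ = k + coeff p a u
  ... | _ | _ = coeff p a u

  _≈P_ : Pol → Pol → Set ℓ
  p ≈P q = ∀ a u → coeff p a u ≈ coeff q a u

  IsZero : Pol → Set ℓ
  IsZero p = ∀ a u → coeff p a u ≈ 0#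

  zeroP : Pol
  zeroP = []

  oneP : Pol
  oneP = (1# , (0 , [])) ∷ []

  var : ℕ → Pol
  var x = (1# , (0 , x ∷ [])) ∷ []

  _+P_ : Pol → Pol → Pol
  _+P_ = _++_

  negP : Pol → Pol
  negP = map λ { (k , μ) → (- k , μ) }

  _*P_ : Pol → Pol → Pol
  p *P q = concatMap (λ { (k , (a , w)) →
             map (λ { (k′ , (a′ , w′)) → (k * k′ , (a ℕ.+ a′ , w ++ w′)) }) q }) p

  tcoeff : ℕ → Pol → Pol
  tcoeff m [] = []
  tcoeff m ((k , (a , w)) ∷ p) with a ≟ℕ m
  ... | yes _ = (k , (0 , w)) ∷ tcoeff m p
  ... | no _ = tcoeff m p

  rename : (ℕ → ℕ) → Pol → Pol
  rename f = map λ { (k , (a , w)) → (k , (a , map f w)) }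

  module _ (n : ℕ) (G : Fin n → Pol) where
    img : ℕ → Pol
    img x with x <? n
    ... | yes x<n = G (fromℕ< x<n)
    ... | no _ = var x

    substMono : Carrier → ℕ → List ℕ → Pol
    substMono k a w = ((k , (a , [])) ∷ []) *P foldr (λ x acc → img x *P acc) oneP w

    subst : Pol → Pol
    subst = concatMap λ { (k , (a , w)) → substMono k a w }

  module _ (D : ℕ → Pol) where
    derivW : List ℕ → Pol
    derivW [] = []
    derivW (x ∷ xs) =
      map (λ { (k , (a , w)) → (k , (a , w ++ xs)) }) (D x)
      ++ map (λ { (k , (a , w)) → (k , (a , x ∷ w)) }) (derivW xs)

    deriv : Pol → Pol
    deriv = concatMap λ { (k , (a , w)) →
              map (λ { (k′ , (a′ , w′)) → (k * k′ , (a ℕ.+ a′ , w′)) }) (derivW w) }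

  -- n variables z₀ … z_{n-1} are x₀ … x_{n-1}; the new variables
  -- w₀ … w_{n-1} are x_n … x_{2n-1}.
  module _ (n : ℕ) where
    toW : Pol → Pol
    toW = rename (n ℕ.+_)

    derW : (Fin n → Pol) → ℕ → Pol
    derW v x with x <? n
    ... | yes x<n = toW (v (fromℕ< x<n))
    ... | no _ = []

    wz : ℕ → ℕ
    wz x with x <? n
    ... | yes _ = x
    ... | no _ = x ∸ n

    wToZ : Pol → Pol
    wToZ = rename wz

    B₊ : List (Fin n → Pol) → Pol → Pol
    B₊ vs u = wToZ (foldr (λ v acc → deriv (derW v) acc) u vs)

    mutual
      P : (Fin n → Pol) → Tree → Fin n → Pol
      P H (node m []) i = tcoeff m (H i)
      P H (node m (t ∷ ts)) i = B₊ (Ps H (t ∷ ts)) (tcoeff m (H i))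

      Ps : (Fin n → Pol) → List Tree → List (Fin n → Pol)
      Ps H [] = []
      Ps H (t ∷ ts) = P H t ∷ Ps H ts

    Fmap : (Fin n → Pol) → Fin n → Pol
    Fmap H i = var (toℕ i) +P negP (H i)

    InVars : Pol → Set ℓ
    InVars p = ∀ a u → Any (n ≤_) u → coeff p a u ≈ 0#

    IsAutomorphism : (Fin n → Pol) → Set (c ⊔ ℓ)
    IsAutomorphism F = Σ (Fin n → Pol) λ G →
      (∀ i → InVars (G i)) ×
      (∀ i → subst n G (F i) ≈P var (toℕ i)) ×
      (∀ i → subst n F (G i) ≈P var (toℕ i))

    InB : ℕ → (Fin n → Pol) → Set (c ⊔ ℓ)
    InB α H =
      (∀ i → InVars (H i)) ×
      IsAutomorphism (Fmap H) ×
      (∀ i u → coeff (H i) 0 u ≈ 0#) ×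
      Σ ℕ (λ d → α ≤ d × (∀ i a u → length u ≢ d → coeff (H i) a u ≈ 0#)) ×
      Σ (Permutation′ n) (λ σ → ∀ i a u → ¬ (coeff (H (σ ⟨$⟩ʳ i)) a u ≈ 0#) →
          All (λ x → Σ (Fin n) λ j → j Fin.< i × x ≡ toℕ (σ ⟨$⟩ʳ j)) u)

-- Number the vertices of T in postorder as 1, …, N and use one further variable z₀.
-- Put H₀ = 0 and, for the vertex x with label m and children c₁, …, c_k,
-- H_x = t^m z₀^{d-k} z_{c₁} ⋯ z_{c_k}, with d ≥ α large enough for every vertex.
-- Since c_j < x, the map z − H is triangular, hence an automorphism (its inverse is
-- reached by iterating G = z + H(G)).  Applying [P_{T_j} ∂/∂z] replaces some z_x by
-- the w-variables of P_{T_j}, and z₀ is killed because P_{T_j} vanishes in component 0;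
-- so a term of P_{T′} in component x witnesses a label-preserving embedding of T′ into
-- the subtree of T at x, which by counting weights is an isomorphism once |T′| ≥ |T|.
-- Conversely the terms of P_T do exist, and all of them have coefficient 1, so their
-- sum has a positive integer coefficient, which is nonzero in a nontrivial ℚ-algebra.
module Submission where

open import Level using (_⊔_)
open import Data.Bool using (Bool; true; false)
open import Data.Empty using (⊥-elim)
open import Data.Nat as Nat using (ℕ; zero; suc; _<_; _≤_; _<?_; z≤n; s≤s)
import Data.Nat.Properties as ℕP
open import Data.Fin as Fin using (Fin; toℕ; fromℕ<)
import Data.Fin.Permutation as Perm
import Data.Fin.Properties as FinP
open import Data.Product using (Σ; ∃; _×_; _,_; proj₁; proj₂)
open import Data.Sum using (_⊎_; inj₁; inj₂; map₂)
open import Data.List as List using (List; []; _∷_; _++_; map; concatMap; foldr; length; replicate)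
import Data.List.Properties as ListP
open import Data.List.Relation.Unary.All as All using (All; []; _∷_)
import Data.List.Relation.Unary.All.Properties as AllP
open import Data.List.Relation.Unary.Any using (here; there)
open import Data.List.Membership.Propositional using (_∈_; _∉_)
import Data.List.Membership.Propositional.Properties as ∈P
open import Data.List.Relation.Binary.Pointwise as Pointwise using (Pointwise; []; _∷_)
open import Data.List.Relation.Binary.Permutation.Propositional as ↭ using (_↭_; prep; swap; ↭-sym; ↭-trans; ↭⇒↭ₛ)
import Data.List.Relation.Binary.Permutation.Propositional.Properties as ↭P
open import Data.List.Sort.InsertionSort.Base ℕP.≤-decTotalOrder using (insert; sort)
open import Data.List.Sort.InsertionSort.Properties ℕP.≤-decTotalOrder using (sort-↭; sort-↗)
open import Data.List.Relation.Unary.Sorted.TotalOrder.Properties using (↗↭↗⇒≋)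
open import Relation.Nullary using (¬_; Dec; yes; no)
open import Relation.Nullary.Decidable using (dec-true; dec-false; _×-dec_)
open import Relation.Binary.PropositionalEquality as ≡ using (_≡_; _≢_)
open import Function using (case_of_; _∘_; id; flip)
open import Algebra.Bundles using (CommutativeRing)
open import Relation.Binary.Bundles using (Setoid)
open import Defs

module WordNormalForm where
  open ≡ using (refl; cong; trans)

  insertℕ≡insert : ∀ x xs → insertℕ x xs ≡ insert x xs
  insertℕ≡insert x [] = refl
  insertℕ≡insert x (y ∷ ys) with x Nat.≤? y
  ... | yes x≤y rewrite dec-true (x Nat.≤? y) x≤y = refl
  ... | no x≰y rewrite dec-false (x Nat.≤? y) x≰y = cong (y ∷_) (insertℕ≡insert x ys)

  sortℕ≡sort : ∀ xs → sortℕ xs ≡ sort xs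
  sortℕ≡sort [] = refl
  sortℕ≡sort (x ∷ xs) = trans (insertℕ≡insert x (sortℕ xs)) (cong (insert x) (sortℕ≡sort xs))

  sortℕ-↭ : ∀ xs → sortℕ xs ↭ xs
  sortℕ-↭ xs rewrite sortℕ≡sort xs = sort-↭ xs

  sortℕ-resp-↭ : ∀ {xs ys} → xs ↭ ys → sortℕ xs ≡ sortℕ ys
  sortℕ-resp-↭ {xs} {ys} xs↭ys rewrite sortℕ≡sort xs | sortℕ≡sort ys =
    Pointwise.Pointwise-≡⇒≡ (↗↭↗⇒≋ ℕP.≤-totalOrder (sort-↗ xs) (sort-↗ ys)
      (↭⇒↭ₛ (↭-trans (sort-↭ xs) (↭-trans xs↭ys (↭-sym (sort-↭ ys))))))

  normW-↭ : ∀ b w → normW b w ↭ w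
  normW-↭ false w = ↭.↭-refl
  normW-↭ true w = sortℕ-↭ w

  length-normW : ∀ b w → length (normW b w) ≡ length w
  length-normW b w = ↭P.↭-length (normW-↭ b w)

  All-normW : ∀ {p} {P : ℕ → Set p} b w → All P w → All P (normW b w)
  All-normW b w = ↭P.All-resp-↭ (↭-sym (normW-↭ b w))

  normW-++-normW : ∀ b w w′ → normW b (normW b w ++ normW b w′) ≡ normW b (w ++ w′)
  normW-++-normW false w w′ = refl
  normW-++-normW true w w′ = sortℕ-resp-↭ (↭P.++⁺ (sortℕ-↭ w) (sortℕ-↭ w′))

module Coefficients {c ℓ} (K : CommutativeRing c ℓ) (b : Bool) where
  open CommutativeRing K
  open Poly K b
  open WordNormalForm
  open import Relation.Binary.Reasoning.Setoid setoid
  open import Algebra.Properties.AbelianGroup +-abelianGroup using (⁻¹-∙-comm; ε⁻¹≈ε)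
  open import Algebra.Properties.CommutativeSemigroup +-commutativeSemigroup using (interchange)
  open import Data.Product.Properties using () renaming (≡-dec to ×-≡-dec)
  open import Data.List.Relation.Unary.Unique.Propositional using (Unique)
  open import Data.List.Relation.Unary.Unique.DecPropositional.Properties using (deduplicate-!)
  open import Data.List.Relation.Unary.AllPairs using (_∷_)

  N : List ℕ → List ℕ
  N = normW b

  wordOf : Carrier × Mono → List ℕ
  wordOf (_ , (_ , w)) = w

  VarsBelow : ℕ → Pol → Set c
  VarsBelow m = All (λ t → All (_< m) (wordOf t))

  vertexPoly : ℕ → ℕ → List ℕ → Pol
  vertexPoly m e cs = (1# , (m , replicate e 0 ++ cs)) ∷ []

  Key : Set
  Key = ℕ × List ℕ

  key : Carrier × Mono → Key
  key (_ , (e , w)) = (e , N w)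

  _≟K_ : (κ μ : Key) → Dec (κ ≡ μ)
  _≟K_ = ×-≡-dec ℕP._≟_ (ListP.≡-dec ℕP._≟_)

  δ : Carrier → Key → Key → Carrier
  δ k (e , v) (a , u) with e ℕP.≟ a | ListP.≡-dec ℕP._≟_ v u
  ... | yes _ | yes _ = k
  ... | _ | _ = 0#

  δ-≡ : ∀ k κ → δ k κ κ ≈ k
  δ-≡ k (e , v) with e ℕP.≟ e | ListP.≡-dec ℕP._≟_ v v
  ... | yes _ | yes _ = refl
  ... | no e≢e | _ = ⊥-elim (e≢e ≡.refl)
  ... | yes _ | no v≢v = ⊥-elim (v≢v ≡.refl)

  δ-≢ : ∀ k {κ μ} → κ ≢ μ → δ k κ μ ≈ 0#
  δ-≢ k {e , v} {a , u} κ≢μ with e ℕP.≟ a | ListP.≡-dec ℕP._≟_ v u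
  ... | yes ≡.refl | yes ≡.refl = ⊥-elim (κ≢μ ≡.refl)
  ... | yes _ | no _ = refl
  ... | no _ | _ = refl

  δ-scale : ∀ k κ μ → δ k κ μ ≈ k * δ 1# κ μ
  δ-scale k (e , v) (a , u) with e ℕP.≟ a | ListP.≡-dec ℕP._≟_ v u
  ... | yes _ | yes _ = sym (*-identityʳ k)
  ... | yes _ | no _ = sym (zeroʳ k)
  ... | no _ | _ = sym (zeroʳ k)

  δ-cong : ∀ {k k′} κ μ → k ≈ k′ → δ k κ μ ≈ δ k′ κ μ
  δ-cong (e , v) (a , u) k≈k′ with e ℕP.≟ a | ListP.≡-dec ℕP._≟_ v u
  ... | yes _ | yes _ = k≈k′
  ... | yes _ | no _ = refl
  ... | no _ | _ = refl

  δ-neg : ∀ k κ μ → δ (- k) κ μ ≈ - δ k κ μ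
  δ-neg k (e , v) (a , u) with e ℕP.≟ a | ListP.≡-dec ℕP._≟_ v u
  ... | yes _ | yes _ = refl
  ... | yes _ | no _ = sym ε⁻¹≈ε
  ... | no _ | _ = sym ε⁻¹≈ε

  coeff-∷ : ∀ t p a u → coeff (t ∷ p) a u ≈ δ (proj₁ t) (key t) (a , u) + coeff p a u
  coeff-∷ (k , (e , w)) p a u with e ℕP.≟ a | ListP.≡-dec ℕP._≟_ (N w) u
  ... | yes _ | yes _ = refl
  ... | yes _ | no _ = sym (+-identityˡ _)
  ... | no _ | _ = sym (+-identityˡ _)

  coeff-support : ∀ p a u → coeff p a u ≈ 0# ⊎ ∃ λ t → t ∈ p × key t ≡ (a , u)
  coeff-support [] a u = inj₁ refl
  coeff-support ((k , (e , w)) ∷ p) a u with e ℕP.≟ a | ListP.≡-dec ℕP._≟_ (N w) u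
  ... | yes ≡.refl | yes ≡.refl = inj₂ (_ , here ≡.refl , ≡.refl)
  ... | yes _ | no _ = map₂ (λ { (t , t∈p , eq) → t , there t∈p , eq }) (coeff-support p a u)
  ... | no _ | _ = map₂ (λ { (t , t∈p , eq) → t , there t∈p , eq }) (coeff-support p a u)

  sumOf : ∀ {a} {A : Set a} → (A → Carrier) → List A → Carrier
  sumOf f [] = 0#
  sumOf f (x ∷ xs) = f x + sumOf f xs

  sumOf-cong : ∀ {a} {A : Set a} {f g : A → Carrier} xs → (∀ x → f x ≈ g x) → sumOf f xs ≈ sumOf g xs
  sumOf-cong [] f≈g = refl
  sumOf-cong (x ∷ xs) f≈g = +-cong (f≈g x) (sumOf-cong xs f≈g)

  sumOf-+ : ∀ {a} {A : Set a} (f g : A → Carrier) xs → sumOf (λ x → f x + g x) xs ≈ sumOf f xs + sumOf g xs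
  sumOf-+ f g [] = sym (+-identityˡ 0#)
  sumOf-+ f g (x ∷ xs) = trans (+-congˡ (sumOf-+ f g xs)) (interchange _ _ _ _)

  sumOf-++ : ∀ {a} {A : Set a} (f : A → Carrier) xs ys → sumOf f (xs ++ ys) ≈ sumOf f xs + sumOf f ys
  sumOf-++ f [] ys = sym (+-identityˡ _)
  sumOf-++ f (x ∷ xs) ys = trans (+-congˡ (sumOf-++ f xs ys)) (sym (+-assoc _ _ _))

  sumOf-0 : ∀ {a} {A : Set a} (f : A → Carrier) xs → (∀ x → f x ≈ 0#) → sumOf f xs ≈ 0#
  sumOf-0 f [] f≈0 = refl
  sumOf-0 f (x ∷ xs) f≈0 = trans (+-cong (f≈0 x) (sumOf-0 f xs f≈0)) (+-identityˡ 0#)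

  coeff-++ : ∀ p q a u → coeff (p ++ q) a u ≈ coeff p a u + coeff q a u
  coeff-++ [] q a u = sym (+-identityˡ _)
  coeff-++ (t ∷ p) q a u = begin
    coeff (t ∷ p ++ q) a u                    ≈⟨ coeff-∷ t (p ++ q) a u ⟩
    δ _ (key t) (a , u) + coeff (p ++ q) a u  ≈⟨ +-congˡ (coeff-++ p q a u) ⟩
    δ _ (key t) (a , u) + (coeff p a u + coeff q a u) ≈⟨ sym (+-assoc _ _ _) ⟩
    (δ _ (key t) (a , u) + coeff p a u) + coeff q a u ≈⟨ +-congʳ (sym (coeff-∷ t p a u)) ⟩
    coeff (t ∷ p) a u + coeff q a u ∎

  coeff-negP : ∀ p a u → coeff (negP p) a u ≈ - coeff p a u
  coeff-negP [] a u = sym ε⁻¹≈ε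
  coeff-negP ((k , (e , w)) ∷ p) a u = begin
    coeff ((- k , (e , w)) ∷ negP p) a u                ≈⟨ coeff-∷ (- k , (e , w)) (negP p) a u ⟩
    δ (- k) (e , N w) (a , u) + coeff (negP p) a u     ≈⟨ +-cong (δ-neg k (e , N w) (a , u)) (coeff-negP p a u) ⟩
    - δ k (e , N w) (a , u) + - coeff p a u            ≈⟨ ⁻¹-∙-comm _ _ ⟩
    - (δ k (e , N w) (a , u) + coeff p a u)            ≈⟨ -‿cong (sym (coeff-∷ (k , (e , w)) p a u)) ⟩
    - coeff ((k , (e , w)) ∷ p) a u ∎

  -- _≈P_ wrapped in a record so that the two polynomials are recoverable by unification
  record _≃_ (p q : Pol) : Set ℓ where
    constructor mk≃
    field coeff-≈ : p ≈P q
  open _≃_ public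

  ≃-refl : ∀ {p} → p ≃ p
  ≃-refl = mk≃ λ a u → refl

  ≃-sym : ∀ {p q} → p ≃ q → q ≃ p
  ≃-sym (mk≃ p≈q) = mk≃ λ a u → sym (p≈q a u)

  ≃-trans : ∀ {p q r} → p ≃ q → q ≃ r → p ≃ r
  ≃-trans (mk≃ p≈q) (mk≃ q≈r) = mk≃ λ a u → trans (p≈q a u) (q≈r a u)

  ≡⇒≃ : ∀ {p q} → p ≡ q → p ≃ q
  ≡⇒≃ ≡.refl = ≃-refl

  ≃-setoid : Setoid c ℓ
  ≃-setoid = record
    { Carrier = Pol ; _≈_ = _≃_
    ; isEquivalence = record { refl = ≃-refl ; sym = ≃-sym ; trans = ≃-trans } }

  ++-cong : ∀ {p p′ q q′} → p ≃ p′ → q ≃ q′ → (p ++ q) ≃ (p′ ++ q′)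
  ++-cong {p} {p′} {q} {q′} (mk≃ p≈p′) (mk≃ q≈q′) = mk≃ λ a u →
    trans (coeff-++ p q a u) (trans (+-cong (p≈p′ a u) (q≈q′ a u)) (sym (coeff-++ p′ q′ a u)))

  ++-identityʳ : ∀ p → (p ++ []) ≃ p
  ++-identityʳ p = ≡⇒≃ (ListP.++-identityʳ p)

  ++-negP-cancelʳ : ∀ p q → ((p ++ q) ++ negP q) ≃ p
  ++-negP-cancelʳ p q = mk≃ λ a u → begin
    coeff ((p ++ q) ++ negP q) a u             ≈⟨ coeff-++ (p ++ q) (negP q) a u ⟩
    coeff (p ++ q) a u + coeff (negP q) a u    ≈⟨ +-cong (coeff-++ p q a u) (coeff-negP q a u) ⟩
    (coeff p a u + coeff q a u) + - coeff q a u ≈⟨ +-assoc _ _ _ ⟩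
    coeff p a u + (coeff q a u + - coeff q a u) ≈⟨ +-congˡ (-‿inverseʳ _) ⟩
    coeff p a u + 0#                           ≈⟨ +-identityʳ _ ⟩
    coeff p a u ∎

  ++-negP-cancelˡ : ∀ p q → ((p ++ negP q) ++ q) ≃ p
  ++-negP-cancelˡ p q = mk≃ λ a u → begin
    coeff ((p ++ negP q) ++ q) a u             ≈⟨ coeff-++ (p ++ negP q) q a u ⟩
    coeff (p ++ negP q) a u + coeff q a u      ≈⟨ +-congʳ (coeff-++ p (negP q) a u) ⟩
    (coeff p a u + coeff (negP q) a u) + coeff q a u ≈⟨ +-assoc _ _ _ ⟩
    coeff p a u + (coeff (negP q) a u + coeff q a u) ≈⟨ +-congˡ (+-congʳ (coeff-negP q a u)) ⟩
    coeff p a u + (- coeff q a u + coeff q a u) ≈⟨ +-congˡ (-‿inverseˡ _) ⟩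
    coeff p a u + 0#                           ≈⟨ +-identityʳ _ ⟩
    coeff p a u ∎

  coeffAt : Pol → Key → Carrier
  coeffAt p (a , u) = coeff p a u

  ⟪_,_⟫ : Pol → (Key → Carrier) → Carrier
  ⟪ p , f ⟫ = sumOf (λ t → proj₁ t * f (key t)) p

  sumOf-δ-∉ : ∀ k κ (f : Key → Carrier) S → κ ∉ S → sumOf (λ μ → δ k κ μ * f μ) S ≈ 0#
  sumOf-δ-∉ k κ f [] κ∉S = refl
  sumOf-δ-∉ k κ f (μ ∷ S) κ∉S = trans
    (+-cong (trans (*-congʳ (δ-≢ k (λ κ≡μ → κ∉S (here κ≡μ)))) (zeroˡ _)) (sumOf-δ-∉ k κ f S (κ∉S ∘ there)))
    (+-identityˡ 0#)

  sumOf-δ-∈ : ∀ k κ (f : Key → Carrier) S → Unique S → κ ∈ S → sumOf (λ μ → δ k κ μ * f μ) S ≈ k * f κ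
  sumOf-δ-∈ k κ f (κ ∷ S) (κ∉S ∷ _) (here ≡.refl) = trans
    (+-cong (*-congʳ (δ-≡ k κ)) (sumOf-δ-∉ k κ f S (λ κ∈S → All.lookup κ∉S κ∈S ≡.refl)))
    (+-identityʳ _)
  sumOf-δ-∈ k κ f (μ ∷ S) (μ∉S ∷ uniq) (there κ∈S) = trans
    (+-cong (trans (*-congʳ (δ-≢ k (λ κ≡μ → All.lookup μ∉S κ∈S (≡.sym κ≡μ)))) (zeroˡ _))
            (sumOf-δ-∈ k κ f S uniq κ∈S))
    (+-identityˡ _)

  ⟪⟫-by-keys : ∀ (f : Key → Carrier) S → Unique S → ∀ p → All (λ t → key t ∈ S) p →
               ⟪ p , f ⟫ ≈ sumOf (λ μ → coeffAt p μ * f μ) S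
  ⟪⟫-by-keys f S uniq [] _ = sym (sumOf-0 _ S (λ { (a , u) → zeroˡ _ }))
  ⟪⟫-by-keys f S uniq ((k , (e , w)) ∷ p) (κ∈S ∷ keys∈S) = begin
    k * f (e , N w) + ⟪ p , f ⟫
      ≈⟨ +-cong (sym (sumOf-δ-∈ k (e , N w) f S uniq κ∈S)) (⟪⟫-by-keys f S uniq p keys∈S) ⟩
    sumOf (λ μ → δ k (e , N w) μ * f μ) S + sumOf (λ μ → coeffAt p μ * f μ) S
      ≈⟨ sym (sumOf-+ _ _ S) ⟩
    sumOf (λ μ → δ k (e , N w) μ * f μ + coeffAt p μ * f μ) S
      ≈⟨ sumOf-cong S (λ { (a , u) → trans (sym (distribʳ _ _ _)) (*-congʳ (sym (coeff-∷ (k , (e , w)) p a u))) }) ⟩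
    sumOf (λ μ → coeffAt ((k , (e , w)) ∷ p) μ * f μ) S ∎

  ⟪⟫-resp-≃ : ∀ (f : Key → Carrier) {p q} → p ≃ q → ⟪ p , f ⟫ ≈ ⟪ q , f ⟫
  ⟪⟫-resp-≃ f {p} {q} (mk≃ p≈q) = begin
    ⟪ p , f ⟫                            ≈⟨ ⟪⟫-by-keys f S uniq p (All.tabulate (∈S ∘ ∈P.∈-++⁺ˡ ∘ ∈P.∈-map⁺ key)) ⟩
    sumOf (λ μ → coeffAt p μ * f μ) S    ≈⟨ sumOf-cong S (λ { (a , u) → *-congʳ (p≈q a u) }) ⟩
    sumOf (λ μ → coeffAt q μ * f μ) S
      ≈⟨ sym (⟪⟫-by-keys f S uniq q (All.tabulate (∈S ∘ ∈P.∈-++⁺ʳ (map key p) ∘ ∈P.∈-map⁺ key))) ⟩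
    ⟪ q , f ⟫ ∎
    where
    keys : List Key
    keys = map key p ++ map key q
    S : List Key
    S = List.deduplicate _≟K_ keys
    uniq : Unique S
    uniq = deduplicate-! _≟K_ keys
    ∈S : ∀ {μ} → μ ∈ keys → μ ∈ S
    ∈S = ∈P.∈-deduplicate⁺ _≟K_

  coeff-outside : ∀ {P : Key → Set} p → All (P ∘ key) p → ∀ a u → ¬ P (a , u) → coeff p a u ≈ 0#
  coeff-outside p keys a u ¬P with coeff-support p a u
  ... | inj₁ ≈0 = ≈0
  ... | inj₂ (t , t∈p , ≡.refl) = ⊥-elim (¬P (All.lookup keys t∈p))

  VarsBelow⇒InVars : ∀ {n} p → VarsBelow n p → InVars n p
  VarsBelow⇒InVars {n} p p<n a u n≤u = coeff-outside {λ κ → All (_< n) (proj₂ κ)} p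
    (All.map (λ {t} → All-normW b (wordOf t)) p<n) a u
    (λ u<n → AllP.All¬⇒¬Any (All.map ℕP.<⇒≱ u<n) n≤u)

module Multiplication {c ℓ} (K : CommutativeRing c ℓ) (b : Bool) where
  open CommutativeRing K
  open Poly K b
  open WordNormalForm
  open Coefficients K b
  open import Relation.Binary.Reasoning.Setoid setoid
  open import Algebra.Properties.Ring ring using (-‿distribˡ-*)

  single : Carrier × Mono → Pol
  single t = t ∷ []

  _≋ᵗ_ : Carrier × Mono → Carrier × Mono → Set ℓ
  (k , μ) ≋ᵗ (k′ , μ′) = k ≈ k′ × μ ≡ μ′

  _≋_ : Pol → Pol → Set (c ⊔ ℓ)
  _≋_ = Pointwise _≋ᵗ_

  ≋⇒≃ : ∀ {p q} → p ≋ q → p ≃ q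
  ≋⇒≃ [] = ≃-refl
  ≋⇒≃ {(k , (e , w)) ∷ p} {(k′ , (e , w)) ∷ q} ((k≈k′ , ≡.refl) ∷ p≋q) = mk≃ λ a u →
    trans (coeff-∷ (k , (e , w)) p a u)
      (trans (+-cong (δ-cong (e , N w) (a , u) k≈k′) (coeff-≈ (≋⇒≃ p≋q) a u)) (sym (coeff-∷ (k′ , (e , w)) q a u)))

  _·_ : Key → Key → Key
  (e , v) · (e′ , v′) = (e Nat.+ e′ , N (v ++ v′))

  mulCoeff : Key → Key → Key → Carrier
  mulCoeff μ κ κ′ = δ 1# (κ · κ′) μ

  key-· : ∀ k e w k′ e′ w′ → key (k * k′ , (e Nat.+ e′ , w ++ w′)) ≡ key (k , (e , w)) · key (k′ , (e′ , w′))
  key-· k e w k′ e′ w′ = ≡.cong (e Nat.+ e′ ,_) (≡.sym (normW-++-normW b w w′))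

  *P-∷ : ∀ t p q → ((t ∷ p) *P q) ≡ ((single t *P q) ++ (p *P q))
  *P-∷ t p q = ≡.cong (_++ (p *P q)) (≡.sym (ListP.++-identityʳ _))

  *P-++ˡ : ∀ p p′ q → ((p ++ p′) *P q) ≡ ((p *P q) ++ (p′ *P q))
  *P-++ˡ p p′ q = ListP.concatMap-++ _ p p′

  single-*P-++ : ∀ t q q′ → (single t *P (q ++ q′)) ≡ ((single t *P q) ++ (single t *P q′))
  single-*P-++ (k , (e , w)) [] q′ = ≡.refl
  single-*P-++ (k , (e , w)) (t′ ∷ q) q′ = ≡.cong (_ ∷_) (single-*P-++ (k , (e , w)) q q′)

  coeff-single-*P : ∀ k e w q a u → coeff (single (k , (e , w)) *P q) a u ≈ k * ⟪ q , mulCoeff (a , u) (e , N w) ⟫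
  coeff-single-*P k e w [] a u = sym (zeroʳ k)
  coeff-single-*P k e w ((k′ , (e′ , w′)) ∷ q) a u = begin
    coeff ((k * k′ , (e Nat.+ e′ , w ++ w′)) ∷ (single (k , (e , w)) *P q)) a u
      ≈⟨ coeff-∷ (k * k′ , (e Nat.+ e′ , w ++ w′)) (single (k , (e , w)) *P q) a u ⟩
    δ (k * k′) (key (k * k′ , (e Nat.+ e′ , w ++ w′))) (a , u) + coeff (single (k , (e , w)) *P q) a u
      ≈⟨ +-cong head (coeff-single-*P k e w q a u) ⟩
    k * (k′ * D (e′ , N w′)) + k * ⟪ q , D ⟫ ≈⟨ sym (distribˡ k _ _) ⟩
    k * ⟪ (k′ , (e′ , w′)) ∷ q , D ⟫ ∎
    where
    D : Key → Carrier
    D = mulCoeff (a , u) (e , N w)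
    head : δ (k * k′) (key (k * k′ , (e Nat.+ e′ , w ++ w′))) (a , u) ≈ k * (k′ * D (e′ , N w′))
    head = begin
      δ (k * k′) (key (k * k′ , (e Nat.+ e′ , w ++ w′))) (a , u)
        ≡⟨ ≡.cong (λ κ → δ (k * k′) κ (a , u)) (key-· k e w k′ e′ w′) ⟩
      δ (k * k′) ((e , N w) · (e′ , N w′)) (a , u) ≈⟨ δ-scale (k * k′) ((e , N w) · (e′ , N w′)) (a , u) ⟩
      (k * k′) * D (e′ , N w′)                    ≈⟨ *-assoc k k′ _ ⟩
      k * (k′ * D (e′ , N w′)) ∎

  coeff-*P : ∀ p q a u → coeff (p *P q) a u ≈ ⟪ p , (λ κ → ⟪ q , mulCoeff (a , u) κ ⟫) ⟫
  coeff-*P [] q a u = refl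
  coeff-*P ((k , (e , w)) ∷ p) q a u = begin
    coeff (((k , (e , w)) ∷ p) *P q) a u
      ≡⟨ ≡.cong (λ r → coeff r a u) (*P-∷ (k , (e , w)) p q) ⟩
    coeff ((single (k , (e , w)) *P q) ++ (p *P q)) a u
      ≈⟨ coeff-++ (single (k , (e , w)) *P q) (p *P q) a u ⟩
    coeff (single (k , (e , w)) *P q) a u + coeff (p *P q) a u
      ≈⟨ +-cong (coeff-single-*P k e w q a u) (coeff-*P p q a u) ⟩
    k * ⟪ q , mulCoeff (a , u) (e , N w) ⟫ + ⟪ p , (λ κ → ⟪ q , mulCoeff (a , u) κ ⟫) ⟫ ∎

  *P-cong : ∀ {p p′ q q′} → p ≃ p′ → q ≃ q′ → (p *P q) ≃ (p′ *P q′)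
  *P-cong {p} {p′} {q} {q′} p≃p′ q≃q′ = mk≃ λ a u → begin
    coeff (p *P q) a u                               ≈⟨ coeff-*P p q a u ⟩
    ⟪ p , (λ κ → ⟪ q , mulCoeff (a , u) κ ⟫) ⟫       ≈⟨ ⟪⟫-resp-≃ (λ κ → ⟪ q , mulCoeff (a , u) κ ⟫) p≃p′ ⟩
    ⟪ p′ , (λ κ → ⟪ q , mulCoeff (a , u) κ ⟫) ⟫
      ≈⟨ sumOf-cong p′ (λ t → *-congˡ (⟪⟫-resp-≃ (mulCoeff (a , u) (key t)) q≃q′)) ⟩
    ⟪ p′ , (λ κ → ⟪ q′ , mulCoeff (a , u) κ ⟫) ⟫      ≈⟨ sym (coeff-*P p′ q′ a u) ⟩
    coeff (p′ *P q′) a u ∎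

  *P-congˡ : ∀ p {q q′} → q ≃ q′ → (p *P q) ≃ (p *P q′)
  *P-congˡ p = *P-cong (≃-refl {p})

  *P-congʳ : ∀ q {p p′} → p ≃ p′ → (p *P q) ≃ (p′ *P q)
  *P-congʳ q p≃p′ = *P-cong p≃p′ (≃-refl {q})

  *P-distribˡ : ∀ p q q′ → (p *P (q ++ q′)) ≃ ((p *P q) ++ (p *P q′))
  *P-distribˡ p q q′ = mk≃ λ a u → begin
    coeff (p *P (q ++ q′)) a u                           ≈⟨ coeff-*P p (q ++ q′) a u ⟩
    ⟪ p , (λ κ → ⟪ q ++ q′ , mulCoeff (a , u) κ ⟫) ⟫    ≈⟨ sumOf-cong p (λ t → *-congˡ (sumOf-++ _ q q′)) ⟩
    ⟪ p , (λ κ → ⟪ q , mulCoeff (a , u) κ ⟫ + ⟪ q′ , mulCoeff (a , u) κ ⟫) ⟫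
      ≈⟨ sumOf-cong p (λ t → distribˡ (proj₁ t) _ _) ⟩
    sumOf (λ t → proj₁ t * ⟪ q , mulCoeff (a , u) (key t) ⟫ + proj₁ t * ⟪ q′ , mulCoeff (a , u) (key t) ⟫) p
      ≈⟨ sumOf-+ _ _ p ⟩
    ⟪ p , (λ κ → ⟪ q , mulCoeff (a , u) κ ⟫) ⟫ + ⟪ p , (λ κ → ⟪ q′ , mulCoeff (a , u) κ ⟫) ⟫
      ≈⟨ +-cong (sym (coeff-*P p q a u)) (sym (coeff-*P p q′ a u)) ⟩
    coeff (p *P q) a u + coeff (p *P q′) a u             ≈⟨ sym (coeff-++ (p *P q) (p *P q′) a u) ⟩
    coeff ((p *P q) ++ (p *P q′)) a u ∎

  *P-zeroʳ : ∀ p → (p *P []) ≃ []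
  *P-zeroʳ p = mk≃ λ a u → trans (coeff-*P p [] a u) (sumOf-0 _ p (λ t → zeroʳ (proj₁ t)))

  *P-identityˡ : ∀ p → (oneP *P p) ≃ p
  *P-identityˡ p = ≋⇒≃ (oneP-*P-≋ p)
    where
    oneP-*P-≋ : ∀ p → (oneP *P p) ≋ p
    oneP-*P-≋ [] = []
    oneP-*P-≋ ((k , μ) ∷ p) = (*-identityˡ k , ≡.refl) ∷ oneP-*P-≋ p

  *P-identityʳ : ∀ p → (p *P oneP) ≃ p
  *P-identityʳ p = ≋⇒≃ (*P-oneP-≋ p)
    where
    *P-oneP-≋ : ∀ p → (p *P oneP) ≋ p
    *P-oneP-≋ [] = []
    *P-oneP-≋ ((k , (e , w)) ∷ p) =
      (*-identityʳ k , ≡.cong₂ _,_ (ℕP.+-identityʳ e) (ListP.++-identityʳ w)) ∷ *P-oneP-≋ p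

  scalar-central : ∀ k e q → (single (k , (e , [])) *P q) ≃ (q *P single (k , (e , [])))
  scalar-central k e q = ≋⇒≃ (scalar-≋ q)
    where
    scalar-≋ : ∀ q → (single (k , (e , [])) *P q) ≋ (q *P single (k , (e , [])))
    scalar-≋ [] = []
    scalar-≋ ((k′ , (e′ , w′)) ∷ q) =
      (*-comm k k′ , ≡.cong₂ _,_ (ℕP.+-comm e e′) (≡.sym (ListP.++-identityʳ w′))) ∷ scalar-≋ q

  *P-assoc : ∀ p q r → ((p *P q) *P r) ≃ (p *P (q *P r))
  *P-assoc p q r = ≋⇒≃ (*P-assoc-≋ p q r)
    where
    ≡-≋-≡ : ∀ {p p′ q q′} → p ≡ p′ → p′ ≋ q′ → q′ ≡ q → p ≋ q
    ≡-≋-≡ ≡.refl p′≋q′ ≡.refl = p′≋q′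

    single-single : ∀ k e w k′ e′ w′ r →
      (single (k * k′ , (e Nat.+ e′ , w ++ w′)) *P r) ≋ (single (k , (e , w)) *P (single (k′ , (e′ , w′)) *P r))
    single-single k e w k′ e′ w′ [] = []
    single-single k e w k′ e′ w′ ((k″ , (e″ , w″)) ∷ r) =
      (*-assoc k k′ k″ , ≡.cong₂ _,_ (ℕP.+-assoc e e′ e″) (ListP.++-assoc w w′ w″)) ∷ single-single k e w k′ e′ w′ r

    single-assoc : ∀ t q r → ((single t *P q) *P r) ≋ (single t *P (q *P r))
    single-assoc (k , (e , w)) [] r = []
    single-assoc (k , (e , w)) ((k′ , (e′ , w′)) ∷ q) r = ≡-≋-≡
      (*P-∷ (k * k′ , (e Nat.+ e′ , w ++ w′)) (single (k , (e , w)) *P q) r)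
      (Pointwise.++⁺ (single-single k e w k′ e′ w′ r) (single-assoc (k , (e , w)) q r))
      (≡.sym (≡.trans (≡.cong (single (k , (e , w)) *P_) (*P-∷ (k′ , (e′ , w′)) q r))
                      (single-*P-++ (k , (e , w)) (single (k′ , (e′ , w′)) *P r) (q *P r))))

    *P-assoc-≋ : ∀ p q r → ((p *P q) *P r) ≋ (p *P (q *P r))
    *P-assoc-≋ [] q r = []
    *P-assoc-≋ (t ∷ p) q r = ≡-≋-≡
      (≡.trans (≡.cong (_*P r) (*P-∷ t p q)) (*P-++ˡ (single t *P q) (p *P q) r))
      (Pointwise.++⁺ (single-assoc t q r) (*P-assoc-≋ p q r))
      (≡.sym (*P-∷ t p (q *P r)))

  single-neg-*P : ∀ k a q → (single (- k , (a , [])) *P q) ≃ negP (single (k , (a , [])) *P q)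
  single-neg-*P k a q = ≋⇒≃ (neg-≋ q)
    where
    neg-≋ : ∀ q → (single (- k , (a , [])) *P q) ≋ negP (single (k , (a , [])) *P q)
    neg-≋ [] = []
    neg-≋ ((k′ , (a′ , w′)) ∷ q) = (sym (-‿distribˡ-* k k′) , ≡.refl) ∷ neg-≋ q

  VarsBelow-*P : ∀ {m} p q → VarsBelow m p → VarsBelow m q → VarsBelow m (p *P q)
  VarsBelow-*P [] q [] q<m = []
  VarsBelow-*P (t ∷ p) q (t<m ∷ p<m) q<m =
    ≡.subst (VarsBelow _) (≡.sym (*P-∷ t p q)) (AllP.++⁺ (single-below t q t<m q<m) (VarsBelow-*P p q p<m q<m))
    where
    single-below : ∀ t q → All (_< _) (wordOf t) → VarsBelow _ q → VarsBelow _ (single t *P q)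
    single-below (k , (e , w)) [] w<m [] = []
    single-below (k , (e , w)) ((k′ , (e′ , w′)) ∷ q) w<m (w′<m ∷ q<m) =
      AllP.++⁺ w<m w′<m ∷ single-below (k , (e , w)) q w<m q<m

module Substitution {c ℓ} (K : CommutativeRing c ℓ) (b : Bool) (n : ℕ) where
  open CommutativeRing K
  open Poly K b
  open Coefficients K b
  open Multiplication K b
  open import Relation.Binary.Reasoning.Setoid ≃-setoid

  idSubst : Fin n → Pol
  idSubst i = var (toℕ i)

  module _ (G : Fin n → Pol) where
    monoImage : List ℕ → Pol
    monoImage = foldr (λ x acc → img n G x *P acc) oneP

    img-< : ∀ {x} (x<n : x < n) → img n G x ≡ G (fromℕ< x<n)
    img-< {x} x<n with x <? n
    ... | yes _ = ≡.refl
    ... | no x≮n = ⊥-elim (x≮n x<n)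

    img-≮ : ∀ {x} → ¬ x < n → img n G x ≡ var x
    img-≮ {x} x≮n with x <? n
    ... | yes x<n = ⊥-elim (x≮n x<n)
    ... | no _ = ≡.refl

    img-toℕ : ∀ i → img n G (toℕ i) ≡ G i
    img-toℕ i = ≡.trans (img-< (FinP.toℕ<n i)) (≡.cong G (FinP.fromℕ<-toℕ i (FinP.toℕ<n i)))

    subst-++ : ∀ p q → subst n G (p ++ q) ≡ (subst n G p ++ subst n G q)
    subst-++ p q = ListP.concatMap-++ _ p q

    subst-single : ∀ k a w → subst n G (single (k , (a , w))) ≃ substMono n G k a w
    subst-single k a w = ++-identityʳ _

    monoImage-++ : ∀ w w′ → monoImage (w ++ w′) ≃ (monoImage w *P monoImage w′)
    monoImage-++ [] w′ = ≃-sym (*P-identityˡ (monoImage w′))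
    monoImage-++ (x ∷ w) w′ = begin
      img n G x *P monoImage (w ++ w′)          ≈⟨ *P-congˡ (img n G x) (monoImage-++ w w′) ⟩
      img n G x *P (monoImage w *P monoImage w′) ≈⟨ ≃-sym (*P-assoc (img n G x) (monoImage w) (monoImage w′)) ⟩
      (img n G x *P monoImage w) *P monoImage w′ ∎

    substMono-* : ∀ k a w k′ a′ w′ →
      substMono n G (k * k′) (a Nat.+ a′) (w ++ w′) ≃ (substMono n G k a w *P substMono n G k′ a′ w′)
    substMono-* k a w k′ a′ w′ = begin
      single (k * k′ , (a Nat.+ a′ , [])) *P monoImage (w ++ w′)
        ≈⟨ *P-cong (≋⇒≃ ((refl , ≡.refl) ∷ [])) (monoImage-++ w w′) ⟩
      (S *P S′) *P (M *P M′) ≈⟨ *P-assoc S S′ _ ⟩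
      S *P (S′ *P (M *P M′)) ≈⟨ *P-congˡ S (≃-sym (*P-assoc S′ M M′)) ⟩
      S *P ((S′ *P M) *P M′) ≈⟨ *P-congˡ S (*P-congʳ M′ (scalar-central k′ a′ M)) ⟩
      S *P ((M *P S′) *P M′) ≈⟨ *P-congˡ S (*P-assoc M S′ M′) ⟩
      S *P (M *P (S′ *P M′)) ≈⟨ ≃-sym (*P-assoc S M _) ⟩
      (S *P M) *P (S′ *P M′) ∎
      where
      S S′ M M′ : Pol
      S = single (k , (a , []))
      S′ = single (k′ , (a′ , []))
      M = monoImage w
      M′ = monoImage w′

    subst-single-*P : ∀ t q → subst n G (single t *P q) ≃ (subst n G (single t) *P subst n G q)
    subst-single-*P (k , (a , w)) [] = ≃-sym (*P-zeroʳ (subst n G (single (k , (a , w)))))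
    subst-single-*P (k , (a , w)) ((k′ , (a′ , w′)) ∷ q) = begin
      substMono n G (k * k′) (a Nat.+ a′) (w ++ w′) ++ subst n G (single (k , (a , w)) *P q)
        ≈⟨ ++-cong (substMono-* k a w k′ a′ w′) (subst-single-*P (k , (a , w)) q) ⟩
      (Mk *P substMono n G k′ a′ w′) ++ (subst n G (single (k , (a , w))) *P subst n G q)
        ≈⟨ ++-cong (≃-refl {Mk *P substMono n G k′ a′ w′}) (*P-congʳ (subst n G q) (subst-single k a w)) ⟩
      (Mk *P substMono n G k′ a′ w′) ++ (Mk *P subst n G q) ≈⟨ ≃-sym (*P-distribˡ Mk _ _) ⟩
      Mk *P (substMono n G k′ a′ w′ ++ subst n G q) ≈⟨ *P-congʳ _ (≃-sym (subst-single k a w)) ⟩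
      subst n G (single (k , (a , w))) *P subst n G ((k′ , (a′ , w′)) ∷ q) ∎
      where
      Mk : Pol
      Mk = substMono n G k a w

    subst-*P : ∀ p q → subst n G (p *P q) ≃ (subst n G p *P subst n G q)
    subst-*P [] q = ≃-refl
    subst-*P (t@(k , (a , w)) ∷ p) q = begin
      subst n G ((t ∷ p) *P q)                                ≡⟨ ≡.cong (subst n G) (*P-∷ t p q) ⟩
      subst n G ((single t *P q) ++ (p *P q))                 ≡⟨ subst-++ (single t *P q) (p *P q) ⟩
      subst n G (single t *P q) ++ subst n G (p *P q)         ≈⟨ ++-cong (subst-single-*P t q) (subst-*P p q) ⟩
      (subst n G (single t) *P subst n G q) ++ (subst n G p *P subst n G q)
        ≈⟨ ++-cong (*P-congʳ (subst n G q) (subst-single k a w)) (≃-refl {subst n G p *P subst n G q}) ⟩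
      (substMono n G k a w *P subst n G q) ++ (subst n G p *P subst n G q)
        ≡⟨ ≡.sym (*P-++ˡ (substMono n G k a w) (subst n G p) (subst n G q)) ⟩
      subst n G (t ∷ p) *P subst n G q ∎

    subst-negP : ∀ p → subst n G (negP p) ≃ negP (subst n G p)
    subst-negP [] = ≃-refl
    subst-negP ((k , (a , w)) ∷ p) = begin
      substMono n G (- k) a w ++ subst n G (negP p)     ≈⟨ ++-cong (single-neg-*P k a (monoImage w)) (subst-negP p) ⟩
      negP (substMono n G k a w) ++ negP (subst n G p)  ≡⟨ ≡.sym (ListP.map-++ _ (substMono n G k a w) (subst n G p)) ⟩
      negP (substMono n G k a w ++ subst n G p) ∎

    subst-var : ∀ x → subst n G (var x) ≃ img n G x
    subst-var x = begin
      substMono n G 1# 0 (x ∷ []) ++ []      ≈⟨ ++-identityʳ _ ⟩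
      oneP *P (img n G x *P oneP)            ≈⟨ *P-identityˡ _ ⟩
      img n G x *P oneP                      ≈⟨ *P-identityʳ (img n G x) ⟩
      img n G x ∎

    subst-oneP : subst n G oneP ≃ oneP
    subst-oneP = ≃-trans (++-identityʳ _) (*P-identityˡ oneP)

  module _ (F G : Fin n → Pol) where
    private
      F∘G : Fin n → Pol
      F∘G i = subst n F (G i)

    img-∘ : ∀ x → subst n F (img n G x) ≃ img n F∘G x
    img-∘ x = case x <? n of λ where
      (yes x<n) → begin
        subst n F (img n G x)      ≡⟨ ≡.cong (subst n F) (img-< G x<n) ⟩
        subst n F (G (fromℕ< x<n)) ≡⟨ ≡.sym (img-< F∘G x<n) ⟩
        img n F∘G x ∎
      (no x≮n) → begin
        subst n F (img n G x) ≡⟨ ≡.cong (subst n F) (img-≮ G x≮n) ⟩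
        subst n F (var x)     ≈⟨ subst-var F x ⟩
        img n F x             ≡⟨ ≡.trans (img-≮ F x≮n) (≡.sym (img-≮ F∘G x≮n)) ⟩
        img n F∘G x ∎

    monoImage-∘ : ∀ w → subst n F (monoImage G w) ≃ monoImage F∘G w
    monoImage-∘ [] = subst-oneP F
    monoImage-∘ (x ∷ w) = begin
      subst n F (img n G x *P monoImage G w)                 ≈⟨ subst-*P F (img n G x) (monoImage G w) ⟩
      subst n F (img n G x) *P subst n F (monoImage G w)     ≈⟨ *P-cong (img-∘ x) (monoImage-∘ w) ⟩
      img n F∘G x *P monoImage F∘G w ∎

    subst-∘ : ∀ p → subst n F (subst n G p) ≃ subst n F∘G p
    subst-∘ [] = ≃-refl
    subst-∘ ((k , (a , w)) ∷ p) = begin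
      subst n F (substMono n G k a w ++ subst n G p)             ≡⟨ subst-++ F (substMono n G k a w) (subst n G p) ⟩
      subst n F (substMono n G k a w) ++ subst n F (subst n G p) ≈⟨ ++-cong monomial (subst-∘ p) ⟩
      substMono n F∘G k a w ++ subst n F∘G p ∎
      where
      monomial : subst n F (substMono n G k a w) ≃ substMono n F∘G k a w
      monomial = begin
        subst n F (single (k , (a , [])) *P monoImage G w)               ≈⟨ subst-*P F (single (k , (a , []))) (monoImage G w) ⟩
        subst n F (single (k , (a , []))) *P subst n F (monoImage G w)   ≈⟨ *P-cong scalar (monoImage-∘ w) ⟩
        single (k , (a , [])) *P monoImage F∘G w ∎
        where
        scalar : subst n F (single (k , (a , []))) ≃ single (k , (a , []))
        scalar = ≃-trans (subst-single F k a []) (*P-identityʳ (single (k , (a , []))))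

  module _ (G G′ : Fin n → Pol) (m : ℕ) (G≃G′ : ∀ {x} → x < m → img n G x ≃ img n G′ x) where
    monoImage-cong-below : ∀ w → All (_< m) w → monoImage G w ≃ monoImage G′ w
    monoImage-cong-below [] [] = ≃-refl
    monoImage-cong-below (x ∷ w) (x<m ∷ w<m) = *P-cong (G≃G′ x<m) (monoImage-cong-below w w<m)

    subst-cong-below : ∀ p → VarsBelow m p → subst n G p ≃ subst n G′ p
    subst-cong-below [] [] = ≃-refl
    subst-cong-below ((k , (a , w)) ∷ p) (w<m ∷ p<m) =
      ++-cong (*P-congˡ (single (k , (a , []))) (monoImage-cong-below w w<m)) (subst-cong-below p p<m)

  subst-id : ∀ p → subst n idSubst p ≃ p
  subst-id [] = ≃-refl
  subst-id ((k , (a , w)) ∷ p) = ++-cong monomial (subst-id p)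
    where
    img-id : ∀ x → img n idSubst x ≡ var x
    img-id x = case x <? n of λ where
      (yes x<n) → ≡.trans (img-< idSubst x<n) (≡.cong var (FinP.toℕ-fromℕ< x<n))
      (no x≮n) → img-≮ idSubst x≮n

    monoImage-id : ∀ w → monoImage idSubst w ≃ single (1# , (0 , w))
    monoImage-id [] = ≃-refl
    monoImage-id (x ∷ w) = begin
      img n idSubst x *P monoImage idSubst w ≈⟨ *P-cong (≡⇒≃ (img-id x)) (monoImage-id w) ⟩
      var x *P single (1# , (0 , w))       ≈⟨ ≋⇒≃ ((*-identityˡ 1# , ≡.refl) ∷ []) ⟩
      single (1# , (0 , x ∷ w)) ∎

    monomial : substMono n idSubst k a w ≃ single (k , (a , w))
    monomial = begin
      single (k , (a , [])) *P monoImage idSubst w ≈⟨ *P-congˡ (single (k , (a , []))) (monoImage-id w) ⟩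
      single (k , (a , [])) *P single (1# , (0 , w)) ≈⟨ ≋⇒≃ ((*-identityʳ k , ≡.cong (_, w) (ℕP.+-identityʳ a)) ∷ []) ⟩
      single (k , (a , w)) ∎

  img-cong-below : ∀ (G G′ : Fin n → Pol) {m} → m ≤ n → (∀ i → toℕ i < m → G i ≃ G′ i) →
                   ∀ {x} → x < m → img n G x ≃ img n G′ x
  img-cong-below G G′ m≤n G≃G′ {x} x<m = begin
    img n G x        ≡⟨ img-< G x<n ⟩
    G (fromℕ< x<n)   ≈⟨ G≃G′ (fromℕ< x<n) (≡.subst (_< _) (≡.sym (FinP.toℕ-fromℕ< x<n)) x<m) ⟩
    G′ (fromℕ< x<n)  ≡⟨ ≡.sym (img-< G′ x<n) ⟩
    img n G′ x ∎
    where
    x<n : x < n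
    x<n = ℕP.<-≤-trans x<m m≤n

  VarsBelow-subst : ∀ (G : Fin n → Pol) → (∀ i → VarsBelow n (G i)) → ∀ p → VarsBelow n p → VarsBelow n (subst n G p)
  VarsBelow-subst G G<n [] [] = []
  VarsBelow-subst G G<n ((k , (a , w)) ∷ p) (w<n ∷ p<n) =
    AllP.++⁺ (VarsBelow-*P (single (k , (a , []))) _ ([] ∷ []) (monoImage-below w w<n)) (VarsBelow-subst G G<n p p<n)
    where
    monoImage-below : ∀ w → All (_< n) w → VarsBelow n (monoImage G w)
    monoImage-below [] [] = [] ∷ []
    monoImage-below (x ∷ w) (x<n ∷ w<n) =
      VarsBelow-*P (img n G x) _ (≡.subst (VarsBelow n) (≡.sym (img-< G x<n)) (G<n _)) (monoImage-below w w<n)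

module TriangularAutomorphism {c ℓ} (K : CommutativeRing c ℓ) (b : Bool) (n : ℕ)
  (H : Fin n → Poly.Pol K b) (H-triangular : ∀ i → Coefficients.VarsBelow K b (toℕ i) (H i)) where
  open CommutativeRing K using (_≈_; 0#)
  open WordNormalForm using (All-normW; length-normW)
  open Poly K b
  open Coefficients K b
  open Multiplication K b
  open Substitution K b n
  open import Relation.Binary.Reasoning.Setoid ≃-setoid

  F : Fin n → Pol
  F = Fmap n H

  -- the approximations of the inverse G = z + H ∘ G, exact in components i < j
  Gᵃ : ℕ → Fin n → Pol
  Gᵃ zero i = var (toℕ i)
  Gᵃ (suc j) i = var (toℕ i) ++ subst n (Gᵃ j) (H i)

  G : Fin n → Pol
  G = Gᵃ n

  toℕ≤n : ∀ (i : Fin n) → toℕ i ≤ n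
  toℕ≤n i = ℕP.<⇒≤ (FinP.toℕ<n i)

  Gᵃ-stable : ∀ j i → toℕ i < j → Gᵃ j i ≃ Gᵃ (suc j) i
  Gᵃ-stable (suc j) i (s≤s i≤j) = ++-cong (≃-refl {var (toℕ i)})
    (subst-cong-below (Gᵃ j) (Gᵃ (suc j)) (toℕ i)
      (img-cong-below (Gᵃ j) (Gᵃ (suc j)) (toℕ≤n i) (λ i′ i′<i → Gᵃ-stable j i′ (ℕP.<-≤-trans i′<i i≤j)))
      (H i) (H-triangular i))

  G-fixed : ∀ i → G i ≃ (var (toℕ i) ++ subst n G (H i))
  G-fixed i = Gᵃ-stable n i (FinP.toℕ<n i)

  G∘F≃id : ∀ i → subst n G (F i) ≃ var (toℕ i)
  G∘F≃id i = begin
    subst n G (var (toℕ i) ++ negP (H i))              ≡⟨ subst-++ G (var (toℕ i)) (negP (H i)) ⟩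
    subst n G (var (toℕ i)) ++ subst n G (negP (H i))  ≈⟨ ++-cong (subst-var G (toℕ i)) (subst-negP G (H i)) ⟩
    img n G (toℕ i) ++ negP (subst n G (H i))          ≡⟨ ≡.cong (_++ negP (subst n G (H i))) (img-toℕ G i) ⟩
    G i ++ negP (subst n G (H i))                      ≈⟨ ++-cong (G-fixed i) ≃-refl ⟩
    (var (toℕ i) ++ subst n G (H i)) ++ negP (subst n G (H i)) ≈⟨ ++-negP-cancelʳ (var (toℕ i)) (subst n G (H i)) ⟩
    var (toℕ i) ∎

  F∘Gᵃ≃id : ∀ j i → toℕ i < j → subst n F (Gᵃ j i) ≃ var (toℕ i)
  F∘Gᵃ≃id (suc j) i (s≤s i≤j) = begin
    subst n F (var (toℕ i) ++ subst n (Gᵃ j) (H i))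
      ≡⟨ subst-++ F (var (toℕ i)) (subst n (Gᵃ j) (H i)) ⟩
    subst n F (var (toℕ i)) ++ subst n F (subst n (Gᵃ j) (H i))
      ≈⟨ ++-cong (≃-trans (subst-var F (toℕ i)) (≡⇒≃ (img-toℕ F i))) (subst-∘ F (Gᵃ j) (H i)) ⟩
    F i ++ subst n (λ i′ → subst n F (Gᵃ j i′)) (H i)
      ≈⟨ ++-cong (≃-refl {F i}) (subst-cong-below _ idSubst (toℕ i)
           (img-cong-below _ idSubst (toℕ≤n i) (λ i′ i′<i → F∘Gᵃ≃id j i′ (ℕP.<-≤-trans i′<i i≤j)))
           (H i) (H-triangular i)) ⟩
    F i ++ subst n idSubst (H i)     ≈⟨ ++-cong (≃-refl {F i}) (subst-id (H i)) ⟩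
    (var (toℕ i) ++ negP (H i)) ++ H i ≈⟨ ++-negP-cancelˡ (var (toℕ i)) (H i) ⟩
    var (toℕ i) ∎

  H-below : ∀ i → VarsBelow n (H i)
  H-below i = All.map (All.map (λ x<i → ℕP.<-trans x<i (FinP.toℕ<n i))) (H-triangular i)

  Gᵃ-below : ∀ j i → VarsBelow n (Gᵃ j i)
  Gᵃ-below zero i = (FinP.toℕ<n i ∷ []) ∷ []
  Gᵃ-below (suc j) i = (FinP.toℕ<n i ∷ []) ∷ VarsBelow-subst (Gᵃ j) (Gᵃ-below j) (H i) (H-below i)

  triangular⇒automorphism : IsAutomorphism n F
  triangular⇒automorphism =
    G , (λ i → VarsBelow⇒InVars (G i) (Gᵃ-below n i)) ,
    (λ i → coeff-≈ (G∘F≃id i)) , (λ i → coeff-≈ (F∘Gᵃ≃id n i (FinP.toℕ<n i)))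

  triangular-support : ∀ i a u → ¬ coeff (H i) a u ≈ 0# → All (λ x → Σ (Fin n) λ j → j Fin.< i × x ≡ toℕ j) u
  triangular-support i a u ≉0 with coeff-support (H i) a u
  ... | inj₁ ≈0 = ⊥-elim (≉0 ≈0)
  ... | inj₂ ((_ , (_ , w)) , t∈ , ≡.refl) = All.map witness (All-normW b w (All.lookup (H-triangular i) t∈))
    where
    witness : ∀ {x} → x < toℕ i → Σ (Fin n) λ j → j Fin.< i × x ≡ toℕ j
    witness {x} x<i = fromℕ< x<n , ≡.subst (_< toℕ i) (≡.sym (FinP.toℕ-fromℕ< x<n)) x<i , ≡.sym (FinP.toℕ-fromℕ< x<n)
      where
      x<n : x < n
      x<n = ℕP.<-trans x<i (FinP.toℕ<n i)

  triangular⇒InB : ∀ α d → α ≤ d →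
    (∀ i → All (λ t → 1 ≤ proj₁ (proj₂ t) × length (wordOf t) ≡ d) (H i)) → InB n α H
  triangular⇒InB α d α≤d terms =
    (λ i → VarsBelow⇒InVars (H i) (H-below i)) ,
    triangular⇒automorphism ,
    (λ i u → coeff-outside {λ κ → 1 ≤ proj₁ κ} (H i) (All.map (λ {t} → 1≤exponent t) (terms i)) 0 u (λ ())) ,
    (d , α≤d , λ i a u → coeff-outside {λ κ → length (proj₂ κ) ≡ d} (H i) (All.map (λ {t} → length≡d t) (terms i)) a u) ,
    (Perm.id , triangular-support)
    where
    1≤exponent : ∀ t → 1 ≤ proj₁ (proj₂ t) × length (wordOf t) ≡ d → 1 ≤ proj₁ (key t)
    1≤exponent (_ , (_ , _)) = proj₁
    length≡d : ∀ t → 1 ≤ proj₁ (proj₂ t) × length (wordOf t) ≡ d → length (proj₂ (key t)) ≡ d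
    length≡d (_ , (_ , w)) (_ , ≡d) = ≡.trans (length-normW b w) ≡d

module TreeEmbedding where
  open ≡ using (refl; cong; cong₂)
  open ℕP
  open Nat using (_+_)

  data _↪_ : Tree → Tree → Set where
    embed : ∀ {m ts ss ss₁ ss₂} → ss ↭ ss₁ ++ ss₂ → Pointwise _↪_ ts ss₁ → node m ts ↪ node m ss

  Positive : Tree → Set
  Positive = LabelsIn (1 ≤_)

  LabelsIn⇒Positive : ∀ {W : ℕ → Set} → (∀ m → W m → 1 ≤ m) → ∀ {T} → LabelsIn W T → Positive T
  LabelsIn⇒Positive W⇒1≤ (node Wm ts) = node (W⇒1≤ _ Wm) (All-LabelsIn⇒Positive ts)
    where
    All-LabelsIn⇒Positive : ∀ {ts} → All (LabelsIn _) ts → All Positive ts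
    All-LabelsIn⇒Positive [] = []
    All-LabelsIn⇒Positive (t ∷ ts) = LabelsIn⇒Positive W⇒1≤ t ∷ All-LabelsIn⇒Positive ts

  weights-++ : ∀ xs ys → weights (xs ++ ys) ≡ weights xs + weights ys
  weights-++ [] ys = refl
  weights-++ (x ∷ xs) ys = ≡.trans (cong (weight x +_) (weights-++ xs ys)) (≡.sym (+-assoc (weight x) _ _))

  weights-↭ : ∀ {xs ys} → xs ↭ ys → weights xs ≡ weights ys
  weights-↭ ↭.refl = refl
  weights-↭ (prep x p) = cong (weight x +_) (weights-↭ p)
  weights-↭ {x ∷ y ∷ _} (swap x y p) = ≡.trans (≡.sym (+-assoc (weight x) (weight y) _))
    (≡.trans (cong₂ _+_ (+-comm (weight x) (weight y)) (weights-↭ p)) (+-assoc (weight y) (weight x) _))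
  weights-↭ (↭.trans p q) = ≡.trans (weights-↭ p) (weights-↭ q)

  weights-split : ∀ {ss} ss₁ {ss₂} → ss ↭ ss₁ ++ ss₂ → weights ss ≡ weights ss₁ + weights ss₂
  weights-split ss₁ p = ≡.trans (weights-↭ p) (weights-++ ss₁ _)

  Positive-weight : ∀ {T} → Positive T → 1 ≤ weight T
  Positive-weight (node {m} 1≤m _) = ≤-trans 1≤m (m≤m+n m _)

  weights-≤0 : ∀ {ts} → All Positive ts → weights ts ≤ 0 → ts ≡ []
  weights-≤0 [] _ = refl
  weights-≤0 (t ∷ _) ≤0 = ⊥-elim (<⇒≱ (≤-trans (Positive-weight t) (m≤m+n _ _)) ≤0)

  +-≤-split : ∀ {a b c d} → a ≤ b → c ≤ d → b + d ≤ a + c → b ≤ a × d ≤ c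
  +-≤-split {a} {b} {c} {d} a≤b c≤d b+d≤a+c =
    +-cancelʳ-≤ d b a (≤-trans b+d≤a+c (+-monoʳ-≤ a c≤d)) ,
    +-cancelˡ-≤ b d c (≤-trans b+d≤a+c (+-monoˡ-≤ c a≤b))

  Pointwise-resp-↭ˡ : ∀ {a r} {A B : Set a} {R : A → B → Set r} {xs xs′ ys} →
    Pointwise R xs ys → xs ↭ xs′ → ∃ λ ys′ → ys ↭ ys′ × Pointwise R xs′ ys′
  Pointwise-resp-↭ˡ rs ↭.refl = _ , ↭.refl , rs
  Pointwise-resp-↭ˡ (r ∷ rs) (prep x p) with Pointwise-resp-↭ˡ rs p
  ... | _ , q , rs′ = _ , prep _ q , r ∷ rs′
  Pointwise-resp-↭ˡ (r₁ ∷ r₂ ∷ rs) (swap x y p) with Pointwise-resp-↭ˡ rs p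
  ... | _ , q , rs′ = _ , swap _ _ q , r₂ ∷ r₁ ∷ rs′
  Pointwise-resp-↭ˡ rs (↭.trans p p′) with Pointwise-resp-↭ˡ rs p
  ... | _ , q , rs′ with Pointwise-resp-↭ˡ rs′ p′
  ... | _ , q′ , rs″ = _ , ↭.trans q q′ , rs″

  Pointwise-resp-↭ʳ : ∀ {a r} {A B : Set a} {R : A → B → Set r} {xs ys ys′} →
    Pointwise R xs ys → ys ↭ ys′ → ∃ λ xs′ → xs ↭ xs′ × Pointwise R xs′ ys′
  Pointwise-resp-↭ʳ {R = R} rs p with Pointwise-resp-↭ˡ (Pointwise.symmetric {R = R} {S = flip R} id rs) p
  ... | xs′ , q , rs′ = xs′ , q , Pointwise.symmetric {R = flip R} {S = R} id rs′

  Pointwise-++ˡ⁻ : ∀ {a r} {A B : Set a} {R : A → B → Set r} xs {xs′ ys} →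
    Pointwise R (xs ++ xs′) ys → ∃ λ ys₁ → ∃ λ ys₂ → ys ≡ ys₁ ++ ys₂ × Pointwise R xs ys₁ × Pointwise R xs′ ys₂
  Pointwise-++ˡ⁻ [] rs = [] , _ , refl , [] , rs
  Pointwise-++ˡ⁻ (x ∷ xs) (r ∷ rs) with Pointwise-++ˡ⁻ xs rs
  ... | ys₁ , ys₂ , refl , rs₁ , rs₂ = _ ∷ ys₁ , ys₂ , refl , r ∷ rs₁ , rs₂

  mutual
    ↪-weight : ∀ {T S} → T ↪ S → weight T ≤ weight S
    ↪-weight (embed {m} {ts} {ss} {ss₁} {ss₂} p es) = +-monoʳ-≤ m (begin
      weights ts                   ≤⟨ ↪-weights es ⟩
      weights ss₁                  ≤⟨ m≤m+n _ _ ⟩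
      weights ss₁ + weights ss₂    ≡⟨ ≡.sym (weights-split ss₁ p) ⟩
      weights ss ∎)
      where open ≤-Reasoning

    ↪-weights : ∀ {ts ss} → Pointwise _↪_ ts ss → weights ts ≤ weights ss
    ↪-weights [] = ≤-refl
    ↪-weights (e ∷ es) = +-mono-≤ (↪-weight e) (↪-weights es)

  mutual
    ↪-tight⇒≅ : ∀ {T S} → T ↪ S → Positive S → weight S ≤ weight T → T ≅ S
    ↪-tight⇒≅ (embed {m} {ts} {ss} {ss₁} {ss₂} p es) (node _ pss) ≤wT =
      iso (proj₁ (proj₂ moved)) (proj₂ (proj₂ moved))
      where
      open ≤-Reasoning
      pos₁₂ : All Positive ss₁ × All Positive ss₂
      pos₁₂ = AllP.++⁻ ss₁ (↭P.All-resp-↭ p pss)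
      tight : weights ss₁ + weights ss₂ ≤ weights ts + 0
      tight = begin
        weights ss₁ + weights ss₂ ≡⟨ ≡.sym (weights-split ss₁ p) ⟩
        weights ss                ≤⟨ +-cancelˡ-≤ m _ _ ≤wT ⟩
        weights ts                ≡⟨ ≡.sym (+-identityʳ _) ⟩
        weights ts + 0 ∎
      split : weights ss₁ ≤ weights ts × weights ss₂ ≤ 0
      split = +-≤-split (↪-weights es) z≤n tight
      ss₂≡[] : ss₂ ≡ []
      ss₂≡[] = weights-≤0 (proj₂ pos₁₂) (proj₂ split)
      ss₁↭ss : ss₁ ↭ ss
      ss₁↭ss = ↭-sym (≡.subst (ss ↭_) (≡.trans (cong (ss₁ ++_) ss₂≡[]) (ListP.++-identityʳ ss₁)) p)
      moved : ∃ λ ts′ → ts ↭ ts′ × Pointwise _≅_ ts′ ss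
      moved = Pointwise-resp-↭ʳ (↪-tight⇒≅s es (proj₁ pos₁₂) (proj₁ split)) ss₁↭ss

    ↪-tight⇒≅s : ∀ {ts ss} → Pointwise _↪_ ts ss → All Positive ss → weights ss ≤ weights ts → Pointwise _≅_ ts ss
    ↪-tight⇒≅s [] [] _ = []
    ↪-tight⇒≅s (e ∷ es) (p ∷ ps) ≤ws with +-≤-split (↪-weight e) (↪-weights es) ≤ws
    ... | ≤w , ≤ws′ = ↪-tight⇒≅ e p ≤w ∷ ↪-tight⇒≅s es ps ≤ws′

  data _⊑_ (S : Tree) : Tree → Set where
    ⊑-refl : S ⊑ S
    ⊑-child : ∀ {m ts t} → S ⊑ t → t ∈ ts → S ⊑ node m ts

  ⊑-LabelsIn : ∀ {W : ℕ → Set} {S T} → S ⊑ T → LabelsIn W T → LabelsIn W S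
  ⊑-LabelsIn ⊑-refl lT = lT
  ⊑-LabelsIn (⊑-child S⊑t t∈ts) (node _ lts) = ⊑-LabelsIn S⊑t (All.lookup lts t∈ts)

  weight-≤-weights : ∀ {t ts} → t ∈ ts → weight t ≤ weights ts
  weight-≤-weights (here refl) = m≤m+n _ _
  weight-≤-weights {ts = t′ ∷ _} (there t∈ts) = ≤-trans (weight-≤-weights t∈ts) (m≤n+m _ (weight t′))

  ⊑⇒≤ : ∀ {S T} → S ⊑ T → weight S ≤ weight T
  ⊑⇒≤ ⊑-refl = ≤-refl
  ⊑⇒≤ {T = node m _} (⊑-child S⊑t t∈ts) = ≤-trans (⊑⇒≤ S⊑t) (≤-trans (weight-≤-weights t∈ts) (m≤n+m _ m))

  ⊑⇒≡⊎< : ∀ {S T} → Positive T → S ⊑ T → S ≡ T ⊎ weight S < weight T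
  ⊑⇒≡⊎< _ ⊑-refl = inj₁ refl
  ⊑⇒≡⊎< (node 1≤m _) (⊑-child S⊑t t∈ts) =
    inj₂ (≤-<-trans (≤-trans (⊑⇒≤ S⊑t) (weight-≤-weights t∈ts)) (m<n+m _ 1≤m))

module DerivationTerms {c ℓ} (K : CommutativeRing c ℓ) (b : Bool) where
  open CommutativeRing K using (Carrier)
  open Poly K b
  open Coefficients K b using (wordOf)
  open ≡ using (refl; cong)

  Term : Set c
  Term = Carrier × Mono

  derivW-∈⁻ : ∀ D w {t} → t ∈ derivW D w →
    ∃ λ A → ∃ λ x → ∃ λ B → ∃ λ (t₀ : Term) → w ≡ A ++ x ∷ B × t₀ ∈ D x × wordOf t ≡ A ++ wordOf t₀ ++ B
  derivW-∈⁻ D (x ∷ xs) t∈ with ∈P.∈-++⁻ (map _ (D x)) t∈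
  ... | inj₁ t∈₁ with ∈P.∈-map⁻ _ t∈₁
  ...   | t₀ , t₀∈ , refl = [] , x , xs , t₀ , refl , t₀∈ , refl
  derivW-∈⁻ D (x ∷ xs) t∈ | inj₂ t∈₂ with ∈P.∈-map⁻ _ t∈₂
  ...   | t₁ , t₁∈ , refl with derivW-∈⁻ D xs t₁∈
  ...     | A , y , B , t₀ , refl , t₀∈ , eq = x ∷ A , y , B , t₀ , refl , t₀∈ , cong (x ∷_) eq

  derivW-∈⁺ : ∀ D A x B {t₀ : Term} → t₀ ∈ D x → ∃ λ t → t ∈ derivW D (A ++ x ∷ B) × wordOf t ≡ A ++ wordOf t₀ ++ B
  derivW-∈⁺ D [] x B t₀∈ = _ , ∈P.∈-++⁺ˡ (∈P.∈-map⁺ _ t₀∈) , refl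
  derivW-∈⁺ D (y ∷ A) x B t₀∈ with derivW-∈⁺ D A x B t₀∈
  ... | t , t∈ , eq = _ , ∈P.∈-++⁺ʳ (map _ (D y)) (∈P.∈-map⁺ _ t∈) , cong (y ∷_) eq

  deriv-∈⁻ : ∀ D p {t} → t ∈ deriv D p → ∃ λ t₁ → ∃ λ t₂ →
    t₁ ∈ p × t₂ ∈ derivW D (wordOf t₁) × wordOf t ≡ wordOf t₂
  deriv-∈⁻ D (t₁ ∷ p) t∈ with ∈P.∈-++⁻ (map _ (derivW D (wordOf t₁))) t∈
  ... | inj₁ t∈₁ with ∈P.∈-map⁻ _ t∈₁
  ...   | t₂ , t₂∈ , refl = t₁ , t₂ , here refl , t₂∈ , refl
  deriv-∈⁻ D (t₁ ∷ p) t∈ | inj₂ t∈₂ with deriv-∈⁻ D p t∈₂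
  ... | s₁ , s₂ , s₁∈ , s₂∈ , eq = s₁ , s₂ , there s₁∈ , s₂∈ , eq

  deriv-∈⁺ : ∀ D p {t₁ t₂} → t₁ ∈ p → t₂ ∈ derivW D (wordOf t₁) → ∃ λ t → t ∈ deriv D p × wordOf t ≡ wordOf t₂
  deriv-∈⁺ D (t₁ ∷ p) (here refl) t₂∈ = _ , ∈P.∈-++⁺ˡ (∈P.∈-map⁺ _ t₂∈) , refl
  deriv-∈⁺ D (s ∷ p) (there t₁∈) t₂∈ with deriv-∈⁺ D p t₁∈ t₂∈
  ... | t , t∈ , eq = t , ∈P.∈-++⁺ʳ (map _ (derivW D (wordOf s))) t∈ , eq

  rename-∈⁻ : ∀ f p {t} → t ∈ rename f p → ∃ λ t′ → t′ ∈ p × wordOf t ≡ map f (wordOf t′)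
  rename-∈⁻ f p t∈ with ∈P.∈-map⁻ _ t∈
  ... | t′ , t′∈ , refl = t′ , t′∈ , refl

  rename-≢[] : ∀ f {p} → p ≢ [] → rename f p ≢ []
  rename-≢[] f {_ ∷ _} _ ()
  rename-≢[] f {[]} p≢[] = ⊥-elim (p≢[] refl)

  module _ (n : ℕ) where
    derW-< : ∀ v {x} (x<n : x < n) → derW n v x ≡ toW n (v (fromℕ< x<n))
    derW-< v {x} x<n with x <? n
    ... | yes _ = refl
    ... | no x≮n = ⊥-elim (x≮n x<n)

    derW-≮ : ∀ v {x} → ¬ x < n → derW n v x ≡ []
    derW-≮ v {x} x≮n with x <? n
    ... | yes x<n = ⊥-elim (x≮n x<n)
    ... | no _ = refl

    derivs : List (Fin n → Pol) → Pol → Pol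
    derivs vs u = foldr (λ v acc → deriv (derW n v) acc) u vs

    derivs-[] : ∀ vs → derivs vs [] ≡ []
    derivs-[] [] = refl
    derivs-[] (v ∷ vs) rewrite derivs-[] vs = refl

module TermsOfP {c ℓ} (K : CommutativeRing c ℓ) (b : Bool) (N : ℕ)
  (H : Fin (suc N) → Poly.Pol K b) (H-zero : H Fin.zero ≡ []) where
  open CommutativeRing K using (1#)
  open Poly K b
  open Coefficients K b using (wordOf; vertexPoly)
  open DerivationTerms K b
  open TreeEmbedding using (_↪_; embed; Pointwise-resp-↭ˡ; Pointwise-++ˡ⁻)
  open ≡ using (refl; cong)

  n : ℕ
  n = suc N

  ∃-∈ : ∀ {a} {A : Set a} {xs : List A} → xs ≢ [] → ∃ (_∈ xs)
  ∃-∈ {xs = []} xs≢[] = ⊥-elim (xs≢[] refl)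
  ∃-∈ {xs = x ∷ _} _ = x , here refl

  ∈⇒≢[] : ∀ {a} {A : Set a} {xs : List A} {x} → x ∈ xs → xs ≢ []
  ∈⇒≢[] (here _) ()
  ∈⇒≢[] (there _) ()

  Proper : ℕ → Set
  Proper x = 1 ≤ x × x < n

  proper? : ∀ x → Dec (Proper x)
  proper? x = 1 Nat.≤? x ×-dec x <? n

  properVars : List ℕ → List ℕ
  properVars = List.filter proper?

  properVars-++ : ∀ w w′ → properVars (w ++ w′) ≡ properVars w ++ properVars w′
  properVars-++ = ListP.filter-++ proper?

  properVars-∷ : ∀ {x} w → Proper x → properVars (x ∷ w) ≡ x ∷ properVars w
  properVars-∷ w = ListP.filter-accept proper? {xs = w}

  properVars-all : ∀ {w} → All Proper w → properVars w ≡ w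
  properVars-all = ListP.filter-all proper?

  properVars-none : ∀ {w} → All (¬_ ∘ Proper) w → properVars w ≡ []
  properVars-none = ListP.filter-none proper?

  properVars-toW : ∀ p {t} → t ∈ toW n p → properVars (wordOf t) ≡ []
  properVars-toW p t∈ with rename-∈⁻ (n Nat.+_) p t∈
  ... | (_ , (_ , w)) , _ , refl = properVars-none {map (n Nat.+_) w} (AllP.map⁺ (All.tabulate λ {x} _ → ℕP.m+n≮m n x ∘ proj₂))

  properVars-replicate0 : ∀ e → properVars (replicate e 0) ≡ []
  properVars-replicate0 e = properVars-none (AllP.replicate⁺ e (λ { (() , _) }))

  P-zero : ∀ T → P n H T Fin.zero ≡ []
  P-zero (node m []) rewrite H-zero = refl
  P-zero (node m (t ∷ ts)) rewrite H-zero = cong (wToZ n) (derivs-[] n (Ps n H (t ∷ ts)))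

  NonzeroAt : Tree → ℕ → Set c
  NonzeroAt T x = derW n (P n H T) x ≢ []

  NonzeroAt-< : ∀ {T x} → NonzeroAt T x → x < n
  NonzeroAt-< {T} {x} nz = case x <? n of λ where
    (yes x<n) → x<n
    (no x≮n) → ⊥-elim (nz (derW-≮ n (P n H T) x≮n))

  NonzeroAt-Proper : ∀ {T x} → NonzeroAt T x → Proper x
  NonzeroAt-Proper {T} {zero} nz = ⊥-elim (nz (≡.trans (derW-< n (P n H T) (s≤s z≤n)) (cong (toW n) (P-zero T))))
  NonzeroAt-Proper {T} {suc x} nz = s≤s z≤n , NonzeroAt-< {T} {suc x} nz

  NonzeroAt⇒P≢[] : ∀ {T x} (x<n : x < n) → NonzeroAt T x → P n H T (fromℕ< x<n) ≢ []
  NonzeroAt⇒P≢[] {T} x<n nz P≡[] = nz (≡.trans (derW-< n (P n H T) x<n) (cong (toW n) P≡[]))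

  P≢[]⇒NonzeroAt : ∀ {T x} (x<n : x < n) → P n H T (fromℕ< x<n) ≢ [] → NonzeroAt T x
  P≢[]⇒NonzeroAt {T} x<n P≢[] eq = rename-≢[] (n Nat.+_) P≢[] (≡.trans (≡.sym (derW-< n (P n H T) x<n)) eq)

  P≢[]⇒derivs : ∀ m ts i → P n H (node m ts) i ≢ [] → ∃ (_∈ derivs n (Ps n H ts) (tcoeff m (H i)))
  P≢[]⇒derivs m [] i P≢[] = ∃-∈ P≢[]
  P≢[]⇒derivs m (s ∷ ts) i P≢[] = ∃-∈ (λ eq → P≢[] (cong (wToZ n) eq))

  derivs⇒P≢[] : ∀ m ts i {t} → t ∈ derivs n (Ps n H ts) (tcoeff m (H i)) → P n H (node m ts) i ≢ []
  derivs⇒P≢[] m [] i t∈ = ∈⇒≢[] t∈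
  derivs⇒P≢[] m (s ∷ ts) i t∈ = rename-≢[] (wz n) (∈⇒≢[] t∈)

  derivs-∈⁻ : ∀ ts p {t} → t ∈ derivs n (Ps n H ts) p →
    ∃ λ t₁ → t₁ ∈ p × ∃ λ ys → Pointwise NonzeroAt ts ys × properVars (wordOf t₁) ↭ ys ++ properVars (wordOf t)
  derivs-∈⁻ [] p {t} t∈ = t , t∈ , [] , [] , ↭.refl
  derivs-∈⁻ (s ∷ ts) p {t} t∈ with deriv-∈⁻ (derW n (P n H s)) (derivs n (Ps n H ts) p) t∈
  ... | t₂ , t₃ , t₂∈ , t₃∈ , t≡t₃ with derivW-∈⁻ (derW n (P n H s)) (wordOf t₂) t₃∈
  ... | A , x , B , t₀ , t₂≡ , t₀∈ , t₃≡ with derivs-∈⁻ ts p t₂∈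
  ... | t₁ , t₁∈ , ys , nzs , t₁↭ = t₁ , t₁∈ , x ∷ ys , nz ∷ nzs , t₁↭′
    where
    open ↭.PermutationReasoning
    nz : NonzeroAt s x
    nz = ∈⇒≢[] t₀∈
    pv₂ : properVars (wordOf t₂) ≡ properVars A ++ x ∷ properVars B
    pv₂ = ≡.trans (cong properVars t₂≡) (≡.trans (properVars-++ A (x ∷ B))
            (cong (properVars A ++_) (properVars-∷ B (NonzeroAt-Proper {s} {x} nz))))
    pv : properVars (wordOf t) ≡ properVars A ++ properVars B
    pv = ≡.trans (cong properVars (≡.trans t≡t₃ t₃≡)) (≡.trans (properVars-++ A (wordOf t₀ ++ B))
           (cong (properVars A ++_) (≡.trans (properVars-++ (wordOf t₀) B)
             (cong (_++ properVars B) (properVars-toW (P n H s (fromℕ< (NonzeroAt-< {s} {x} nz)))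
               (≡.subst (t₀ ∈_) (derW-< n (P n H s) (NonzeroAt-< {s} {x} nz)) t₀∈))))))
    t₁↭′ : properVars (wordOf t₁) ↭ (x ∷ ys) ++ properVars (wordOf t)
    t₁↭′ = begin
      properVars (wordOf t₁)                  ↭⟨ t₁↭ ⟩
      ys ++ properVars (wordOf t₂)            ≡⟨ cong (ys ++_) pv₂ ⟩
      ys ++ (properVars A ++ x ∷ properVars B) ↭⟨ ↭P.++⁺ˡ ys (↭P.shift x (properVars A) (properVars B)) ⟩
      ys ++ x ∷ (properVars A ++ properVars B) ↭⟨ ↭P.shift x ys _ ⟩
      x ∷ ys ++ (properVars A ++ properVars B) ≡⟨ cong (λ w → x ∷ ys ++ w) (≡.sym pv) ⟩
      (x ∷ ys) ++ properVars (wordOf t) ∎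

  derivs-∈⁺ : ∀ ss cs A B u {t} → Pointwise NonzeroAt ss cs → t ∈ u → wordOf t ≡ A ++ cs ++ B →
    ∃ λ t′ → t′ ∈ derivs n (Ps n H ss) u × ∃ λ B′ → wordOf t′ ≡ A ++ B′
  derivs-∈⁺ [] [] A B u {t} [] t∈ t≡ = t , t∈ , B , t≡
  derivs-∈⁺ (s ∷ ss) (x ∷ cs) A B u (nz ∷ nzs) t∈ t≡
    with derivs-∈⁺ ss cs (A ++ x ∷ []) B u nzs t∈ (≡.trans t≡ (≡.sym (ListP.++-assoc A (x ∷ []) (cs ++ B))))
  ... | t′ , t′∈ , B′ , t′≡ with ∃-∈ nz
  ... | t₀ , t₀∈ with derivW-∈⁺ (derW n (P n H s)) A x B′ t₀∈
  ... | t₂ , t₂∈ , t₂≡ with deriv-∈⁺ (derW n (P n H s)) (derivs n (Ps n H ss) u) {t′} {t₂} t′∈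
         (≡.subst (λ w → t₂ ∈ derivW (derW n (P n H s)) w) (≡.sym (≡.trans t′≡ (ListP.++-assoc A (x ∷ []) B′))) t₂∈)
  ... | t₃ , t₃∈ , t₃≡ = t₃ , t₃∈ , wordOf t₀ ++ B′ , ≡.trans t₃≡ t₂≡

  data Represents : ℕ → Tree → Set c where
    represents : ∀ {x m e cs ss} (x<n : x < n) → H (fromℕ< x<n) ≡ vertexPoly m e cs →
                 Pointwise Represents cs ss → Represents x (node m ss)

  Represents-Proper : ∀ {x S} → Represents x S → Proper x
  Represents-Proper {zero} (represents x<n H≡ _) with () ← ≡.trans (≡.sym H-zero) H≡
  Represents-Proper {suc x} (represents x<n _ _) = s≤s z≤n , x<n

  properVars-vertex : ∀ e {cs ss} → Pointwise Represents cs ss → properVars (replicate e 0 ++ cs) ≡ cs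
  properVars-vertex e {cs} reps = ≡.trans (properVars-++ (replicate e 0) cs)
    (≡.trans (cong (_++ properVars cs) (properVars-replicate0 e)) (properVars-all (All-Proper reps)))
    where
    All-Proper : ∀ {cs ss} → Pointwise Represents cs ss → All Proper cs
    All-Proper [] = []
    All-Proper (r ∷ rs) = Represents-Proper r ∷ All-Proper rs

  mutual
    NonzeroAt⇒↪ : ∀ T′ {x S} → Represents x S → NonzeroAt T′ x → T′ ↪ S
    NonzeroAt⇒↪ (node m′ ts′) {x} {node m ss} (represents {e = e} {cs} x<n H≡ reps) nz
      with P≢[]⇒derivs m′ ts′ (fromℕ< x<n) (NonzeroAt⇒P≢[] {node m′ ts′} x<n nz)
    ... | t , t∈ with H (fromℕ< x<n) | H≡
    ... | _ | refl with m ℕP.≟ m′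
    ... | no _ = ⊥-elim (∈⇒≢[] t∈ (derivs-[] n (Ps n H ts′)))
    ... | yes refl with derivs-∈⁻ ts′ _ t∈
    ... | _ , here refl , ys , nzs , cs↭ with Pointwise-resp-↭ˡ reps (≡.subst (_↭ _) (properVars-vertex e reps) cs↭)
    ... | ss′ , ss↭ss′ , reps′ with Pointwise-++ˡ⁻ ys reps′
    ... | _ , _ , refl , reps₁ , _ = embed ss↭ss′ (NonzeroAt⇒↪s ts′ nzs reps₁)

    NonzeroAt⇒↪s : ∀ ts {ys ss} → Pointwise NonzeroAt ts ys → Pointwise Represents ys ss → Pointwise _↪_ ts ss
    NonzeroAt⇒↪s [] [] [] = []
    NonzeroAt⇒↪s (t ∷ ts) (nz ∷ nzs) (r ∷ rs) = NonzeroAt⇒↪ t r nz ∷ NonzeroAt⇒↪s ts nzs rs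

  mutual
    Represents⇒NonzeroAt : ∀ {x S} → Represents x S → NonzeroAt S x
    Represents⇒NonzeroAt {x} {node m ss} (represents {e = e} {cs} x<n H≡ reps) =
      P≢[]⇒NonzeroAt {node m ss} x<n (derivs⇒P≢[] m ss (fromℕ< x<n) (proj₁ (proj₂ found)))
      where
      tc≡ : tcoeff m (H (fromℕ< x<n)) ≡ (1# , (0 , replicate e 0 ++ cs)) ∷ []
      tc≡ = ≡.trans (cong (tcoeff m) H≡) (tcoeff-at m)
        where
        tcoeff-at : ∀ m → tcoeff m (vertexPoly m e cs) ≡ (1# , (0 , replicate e 0 ++ cs)) ∷ []
        tcoeff-at m with m ℕP.≟ m
        ... | yes _ = refl
        ... | no m≢m = ⊥-elim (m≢m refl)
      found : ∃ λ t′ → t′ ∈ derivs n (Ps n H ss) (tcoeff m (H (fromℕ< x<n))) × ∃ λ B′ → wordOf t′ ≡ replicate e 0 ++ B′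
      found = derivs-∈⁺ ss cs (replicate e 0) [] (tcoeff m (H (fromℕ< x<n))) (Represents⇒NonzeroAts reps)
                (≡.subst ((1# , (0 , replicate e 0 ++ cs)) ∈_) (≡.sym tc≡) (here refl))
                (cong (replicate e 0 ++_) (≡.sym (ListP.++-identityʳ cs)))

    Represents⇒NonzeroAts : ∀ {cs ss} → Pointwise Represents cs ss → Pointwise NonzeroAt ss cs
    Represents⇒NonzeroAts [] = []
    Represents⇒NonzeroAts (r ∷ rs) = Represents⇒NonzeroAt r ∷ Represents⇒NonzeroAts rs

module UnitCoefficients {c ℓ} (K : CommutativeRing c ℓ) (b : Bool) where
  open CommutativeRing K
  open Poly K b
  open Coefficients K b
  open DerivationTerms K b
  open import Algebra.Definitions.RawMonoid +-rawMonoid using () renaming (_×_ to _×ₘ_)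
  open import Relation.Binary.Reasoning.Setoid setoid
  open import Algebra.Morphism.Structures using (module RingMorphisms)
  import Data.Rational as ℚ
  import Data.Rational.Properties as ℚP
  open import Algebra.Definitions.RawMonoid ℚ.+-0-rawMonoid using () renaming (_×_ to _×ℚ_)

  UnitTerms : Pol → Set (c ⊔ ℓ)
  UnitTerms = All (λ t → proj₁ t ≈ 1#)

  coeff-UnitTerms : ∀ p a u → UnitTerms p →
    ∃ λ k → coeff p a u ≈ k ×ₘ 1# × (∀ {t} → t ∈ p → key t ≡ (a , u) → 1 ≤ k)
  coeff-UnitTerms [] a u [] = 0 , refl , λ ()
  coeff-UnitTerms ((k , (e , w)) ∷ p) a u (k≈1 ∷ ps) with coeff-UnitTerms p a u ps | e ℕP.≟ a | ListP.≡-dec ℕP._≟_ (N w) u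
  ... | j , ≈j , _ | yes _ | yes _ = suc j , +-cong k≈1 ≈j , λ _ _ → s≤s z≤n
  ... | j , ≈j , 1≤j | yes _ | no Nw≢u = j , ≈j , λ
    { (here ≡.refl) ≡.refl → ⊥-elim (Nw≢u ≡.refl)
    ; (there t∈) eq → 1≤j t∈ eq }
  ... | j , ≈j , 1≤j | no e≢a | _ = j , ≈j , λ
    { (here ≡.refl) ≡.refl → ⊥-elim (e≢a ≡.refl)
    ; (there t∈) eq → 1≤j t∈ eq }

  UnitTerms-map : ∀ f {p} → (∀ t → proj₁ (f t) ≡ proj₁ t) → UnitTerms p → UnitTerms (map f p)
  UnitTerms-map f keeps ps = AllP.map⁺ (All.map (λ {t} t≈1 → ≡.subst (_≈ 1#) (≡.sym (keeps t)) t≈1) ps)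

  UnitTerms-tcoeff : ∀ m p → UnitTerms p → UnitTerms (tcoeff m p)
  UnitTerms-tcoeff m [] [] = []
  UnitTerms-tcoeff m ((k , (a , w)) ∷ p) (k≈1 ∷ ps) with a ℕP.≟ m
  ... | yes _ = k≈1 ∷ UnitTerms-tcoeff m p ps
  ... | no _ = UnitTerms-tcoeff m p ps

  UnitTerms-rename : ∀ f p → UnitTerms p → UnitTerms (rename f p)
  UnitTerms-rename f p = UnitTerms-map _ (λ _ → ≡.refl)

  UnitTerms-derivW : ∀ D → (∀ x → UnitTerms (D x)) → ∀ w → UnitTerms (derivW D w)
  UnitTerms-derivW D Ds [] = []
  UnitTerms-derivW D Ds (x ∷ xs) = AllP.++⁺ (UnitTerms-map _ (λ _ → ≡.refl) (Ds x))
                                            (UnitTerms-map _ (λ _ → ≡.refl) (UnitTerms-derivW D Ds xs))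

  UnitTerms-deriv : ∀ D → (∀ x → UnitTerms (D x)) → ∀ p → UnitTerms p → UnitTerms (deriv D p)
  UnitTerms-deriv D Ds [] [] = []
  UnitTerms-deriv D Ds ((k , (a , w)) ∷ p) (k≈1 ∷ ps) =
    AllP.++⁺ (AllP.map⁺ (All.map (λ k′≈1 → trans (*-cong k≈1 k′≈1) (*-identityˡ 1#)) (UnitTerms-derivW D Ds w)))
             (UnitTerms-deriv D Ds p ps)

  UnitTerms-derW : ∀ n v → (∀ i → UnitTerms (v i)) → ∀ x → UnitTerms (derW n v x)
  UnitTerms-derW n v vs x = case x <? n of λ where
    (yes x<n) → ≡.subst UnitTerms (≡.sym (derW-< n v x<n)) (UnitTerms-rename (n Nat.+_) _ (vs (fromℕ< x<n)))
    (no x≮n) → ≡.subst UnitTerms (≡.sym (derW-≮ n v x≮n)) []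

  module _ (n : ℕ) (H : Fin n → Pol) (Hs : ∀ i → UnitTerms (H i)) where
    mutual
      UnitTerms-P : ∀ T i → UnitTerms (P n H T i)
      UnitTerms-P (node m []) i = UnitTerms-tcoeff m (H i) (Hs i)
      UnitTerms-P (node m (t ∷ ts)) i =
        UnitTerms-rename (wz n) _ (UnitTerms-derivs (t ∷ ts) (UnitTerms-tcoeff m (H i) (Hs i)))

      UnitTerms-derivs : ∀ ts {u} → UnitTerms u → UnitTerms (derivs n (Ps n H ts) u)
      UnitTerms-derivs [] us = us
      UnitTerms-derivs (t ∷ ts) us =
        UnitTerms-deriv (derW n (P n H t)) (UnitTerms-derW n (P n H t) (UnitTerms-P t)) _ (UnitTerms-derivs ts us)

  module _ (f : ℚ.ℚ → Carrier) (f-hom : RingMorphisms.IsRingHomomorphism ℚP.+-*-rawRing rawRing f) (1≉0 : ¬ 1# ≈ 0#) where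
    open RingMorphisms.IsRingHomomorphism f-hom

    ×ℚ-nonNeg : ∀ k → ℚ.0ℚ ℚ.≤ k ×ℚ ℚ.1ℚ
    ×ℚ-nonNeg zero = ℚP.≤-refl
    ×ℚ-nonNeg (suc k) = ≡.subst (ℚ._≤ suc k ×ℚ ℚ.1ℚ) (ℚP.+-identityˡ ℚ.0ℚ)
      (ℚP.+-mono-≤ (ℚP.<⇒≤ (ℚP.positive⁻¹ ℚ.1ℚ)) (×ℚ-nonNeg k))

    ×ℚ-pos : ∀ k → ℚ.0ℚ ℚ.< suc k ×ℚ ℚ.1ℚ
    ×ℚ-pos k = ≡.subst (ℚ._< suc k ×ℚ ℚ.1ℚ) (ℚP.+-identityˡ ℚ.0ℚ)
      (ℚP.+-mono-<-≤ (ℚP.positive⁻¹ ℚ.1ℚ) (×ℚ-nonNeg k))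

    f-× : ∀ k → f (k ×ℚ ℚ.1ℚ) ≈ k ×ₘ 1#
    f-× zero = 0#-homo
    f-× (suc k) = trans (+-homo ℚ.1ℚ (k ×ℚ ℚ.1ℚ)) (+-cong 1#-homo (f-× k))

    -- K is a ℚ-algebra: the image of 1/(k+1) inverts k+1
    suc×1≉0 : ∀ k → ¬ suc k ×ₘ 1# ≈ 0#
    suc×1≉0 k k≈0 = 1≉0 (begin
      1#                      ≈⟨ sym 1#-homo ⟩
      f ℚ.1ℚ                  ≡⟨ ≡.cong f (≡.sym (ℚP.*-inverseʳ q {{q≢0}})) ⟩
      f (q ℚ.* ℚ.1/ q)        ≈⟨ *-homo q _ ⟩
      f q * f (ℚ.1/ q)        ≈⟨ *-congʳ (trans (f-× (suc k)) k≈0) ⟩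
      0# * f (ℚ.1/ q)         ≈⟨ zeroˡ _ ⟩
      0# ∎)
      where
      q : ℚ.ℚ
      q = suc k ×ℚ ℚ.1ℚ
      instance
        q≢0 : ℚ.NonZero q
        q≢0 = ℚP.pos⇒nonZero q {{ℚ.positive (×ℚ-pos k)}}

    UnitTerms-∈⇒coeff≉0 : ∀ p → UnitTerms p → ∀ {t} → t ∈ p → ¬ coeff p (proj₁ (proj₂ t)) (N (wordOf t)) ≈ 0#
    UnitTerms-∈⇒coeff≉0 p ps {t@(_ , (_ , _))} t∈ ≈0 with coeff-UnitTerms p _ _ ps
    ... | zero , _ , 1≤k = ℕP.<⇒≱ (1≤k t∈ ≡.refl) z≤n
    ... | suc k , ≈k , _ = suc×1≉0 k (trans (sym ≈k) ≈0)

module PostorderLayout where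
  open ≡ using (refl; cong; sym; trans)
  open ℕP
  open Nat using (_+_; _∸_)

  -- a vertex: its label and the indices of its children
  Vertex : Set
  Vertex = ℕ × List ℕ

  mutual
    vertices : ℕ → Tree → List Vertex
    vertices off (node m ts) = verticesL off ts ++ (m , roots off ts) ∷ []

    verticesL : ℕ → List Tree → List Vertex
    verticesL off [] = []
    verticesL off (t ∷ ts) = vertices off t ++ verticesL (off + length (vertices off t)) ts

    roots : ℕ → List Tree → List ℕ
    roots off [] = []
    roots off (t ∷ ts) = rootIndex off t ∷ roots (off + length (vertices off t)) ts

    rootIndex : ℕ → Tree → ℕ
    rootIndex off (node m ts) = off + length (verticesL off ts)

  vertexAt : List Vertex → ℕ → Vertex
  vertexAt [] _ = (0 , [])
  vertexAt (v ∷ vs) zero = v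
  vertexAt (v ∷ vs) (suc j) = vertexAt vs j

  vertexAt-++ : ∀ pre vs j → vertexAt (pre ++ vs) (length pre + j) ≡ vertexAt vs j
  vertexAt-++ [] vs j = refl
  vertexAt-++ (v ∷ pre) vs j = vertexAt-++ pre vs j

  length-vertices : ∀ off m ts → length (vertices off (node m ts)) ≡ suc (length (verticesL off ts))
  length-vertices off m ts = trans (ListP.length-++ (verticesL off ts)) (+-comm _ 1)

  rootIndex-< : ∀ off T → rootIndex off T < off + length (vertices off T)
  rootIndex-< off (node m ts) rewrite length-vertices off m ts = +-monoʳ-< off (n<1+n _)

  roots-bounded : ∀ off ts → All (λ r → off ≤ r × r < off + length (verticesL off ts)) (roots off ts)
  roots-bounded off [] = []
  roots-bounded off (t@(node _ _) ∷ ts) =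
    (m≤m+n off _ , <-≤-trans (rootIndex-< off t) (+-monoʳ-≤ off (≡.subst (length (vertices off t) ≤_)
      (sym (ListP.length-++ (vertices off t))) (m≤m+n _ _))))
    ∷ All.map (λ {r} (off′≤r , r<) → ≤-trans (m≤m+n off _) off′≤r , ≡.subst (r <_) bound r<)
              (roots-bounded (off + length (vertices off t)) ts)
    where
    bound : off + length (vertices off t) + length (verticesL (off + length (vertices off t)) ts)
            ≡ off + length (verticesL off (t ∷ ts))
    bound = trans (+-assoc off _ _) (cong (off +_) (sym (ListP.length-++ (vertices off t))))

  module _ (V : List Vertex) where
    -- xs occurs in V starting at the 1-based index off
    Window : ℕ → List Vertex → Set
    Window off xs = ∃ λ pre → ∃ λ post → V ≡ pre ++ xs ++ post × suc (length pre) ≡ off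

    Window-++ : ∀ off xs ys → Window off (xs ++ ys) → Window off xs × Window (off + length xs) ys
    Window-++ off xs ys (pre , post , V≡ , refl) =
      (pre , ys ++ post , trans V≡ (cong (pre ++_) (ListP.++-assoc xs ys post)) , refl) ,
      (pre ++ xs , post , trans V≡ (trans (cong (pre ++_) (ListP.++-assoc xs ys post)) (sym (ListP.++-assoc pre xs (ys ++ post)))) ,
        cong suc (ListP.length-++ pre))

    Window-head : ∀ off v vs → Window off (v ∷ vs) → vertexAt V (off ∸ 1) ≡ v
    Window-head off v vs (pre , post , refl , refl) =
      ≡.trans (≡.cong (vertexAt V) (sym (+-identityʳ (length pre)))) (vertexAt-++ pre (v ∷ vs ++ post) 0)

    Window-bound : ∀ off xs → Window off xs → off + length xs ≤ suc (length V)
    Window-bound off xs (pre , post , refl , refl) = s≤s (begin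
      length pre + length xs                       ≤⟨ +-monoʳ-≤ (length pre) (m≤m+n _ _) ⟩
      length pre + (length xs + length post)       ≡⟨ cong (length pre +_) (sym (ListP.length-++ xs)) ⟩
      length pre + length (xs ++ post)             ≡⟨ sym (ListP.length-++ pre) ⟩
      length (pre ++ xs ++ post) ∎)
      where open ≤-Reasoning

    Window-pos : ∀ off xs → Window off xs → 1 ≤ off
    Window-pos off xs (pre , post , _ , refl) = s≤s z≤n

module Construction {c ℓ} (K : CommutativeRing c ℓ) (b : Bool) (α : ℕ) (T : Tree) where
  open CommutativeRing K using (Carrier; _≈_; 0#; 1#; rawRing) renaming (refl to ≈-refl)
  open Poly K b
  open Coefficients K b using (vertexPoly; wordOf; key; VarsBelow)
  open UnitCoefficients K b using (UnitTerms; UnitTerms-P; UnitTerms-∈⇒coeff≉0)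
  open import Algebra.Morphism.Structures using (module RingMorphisms)
  import Data.Rational as ℚ
  import Data.Rational.Properties as ℚP
  open PostorderLayout
  open TreeEmbedding
  open ≡ using (refl; cong; sym; trans)
  open Nat using (_+_; _∸_)
  open import Relation.Binary.Definitions using (tri<; tri≈; tri>)
  open import Data.Nat.ListAction using (sum)

  V : List Vertex
  V = vertices 1 T

  N : ℕ
  N = length V

  n : ℕ
  n = suc N

  childCount : List Vertex → ℕ
  childCount = sum ∘ map (length ∘ proj₂)

  d : ℕ
  d = α + childCount V

  vertexPolyOf : Vertex → Pol
  vertexPolyOf v = vertexPoly (proj₁ v) (d ∸ length (proj₂ v)) (proj₂ v)

  H : Fin n → Pol
  H Fin.zero = []
  H (Fin.suc i) = vertexPolyOf (vertexAt V (toℕ i))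

  open TermsOfP K b N H refl hiding (n)

  label : Tree → ℕ
  label (node m _) = m

  VertexInfo : ℕ → Tree → Set
  VertexInfo x S = ∃ λ cs → vertexAt V (x ∸ 1) ≡ (label S , cs) × All (_< x) cs

  H-at : ∀ {x} (x<n : x < n) → 1 ≤ x → H (fromℕ< x<n) ≡ vertexPolyOf (vertexAt V (x ∸ 1))
  H-at {suc x} x<n _ = cong (vertexPolyOf ∘ vertexAt V) (FinP.toℕ-fromℕ< (ℕP.≤-pred x<n))

  window-V : Window V 1 V
  window-V = [] , [] , sym (ListP.++-identityʳ V) , refl

  root-info : ∀ off T′ → Window V off (vertices off T′) → VertexInfo (rootIndex off T′) T′
  root-info off (node m ts) w with Window-++ V off (verticesL off ts) ((m , roots off ts) ∷ []) w
  ... | _ , w₂ = roots off ts , Window-head V _ _ [] w₂ , All.map proj₂ (roots-bounded off ts)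

  mutual
    represents-root : ∀ off T′ → Window V off (vertices off T′) → Represents (rootIndex off T′) T′
    represents-root off (node m ts) w with Window-++ V off (verticesL off ts) ((m , roots off ts) ∷ []) w
    ... | w₁ , w₂ = represents x<n H≡ (represents-roots off ts w₁)
      where
      x : ℕ
      x = off + length (verticesL off ts)
      x<n : x < n
      x<n = ≡.subst (_≤ n) (ℕP.+-comm x 1) (Window-bound V x _ w₂)
      H≡ : H (fromℕ< x<n) ≡ vertexPoly m (d ∸ length (roots off ts)) (roots off ts)
      H≡ = trans (H-at x<n (Window-pos V x _ w₂)) (cong vertexPolyOf (Window-head V x _ [] w₂))

    represents-roots : ∀ off ts → Window V off (verticesL off ts) → Pointwise Represents (roots off ts) ts
    represents-roots off [] w = []
    represents-roots off (t ∷ ts) w with Window-++ V off (vertices off t) (verticesL (off + length (vertices off t)) ts) w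
    ... | w₁ , w₂ = represents-root off t w₁ ∷ represents-roots (off + length (vertices off t)) ts w₂

  mutual
    vertex-subtree : ∀ off T′ → Window V off (vertices off T′) → ∀ j → j < length (vertices off T′) →
      ∃ λ S → S ⊑ T′ × Represents (off + j) S × VertexInfo (off + j) S
    vertex-subtree off (node m ts) w j j< with Window-++ V off (verticesL off ts) ((m , roots off ts) ∷ []) w
    ... | w₁ , _ with ℕP.<-cmp j (length (verticesL off ts))
    ... | tri< j<′ _ _ with vertex-subtrees off ts w₁ j j<′
    ...   | S , t , t∈ts , S⊑t , info = S , ⊑-child S⊑t t∈ts , info
    vertex-subtree off (node m ts) w j j< | _ | tri≈ _ refl _ =
      node m ts , ⊑-refl , represents-root off (node m ts) w , root-info off (node m ts) w
    vertex-subtree off (node m ts) w j j< | _ | tri> _ _ j> =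
      ⊥-elim (ℕP.<⇒≱ j< (≡.subst (_≤ j) (sym (length-vertices off m ts)) j>))

    vertex-subtrees : ∀ off ts → Window V off (verticesL off ts) → ∀ j → j < length (verticesL off ts) →
      ∃ λ S → ∃ λ t → t ∈ ts × S ⊑ t × Represents (off + j) S × VertexInfo (off + j) S
    vertex-subtrees off (t ∷ ts) w j j< with Window-++ V off (vertices off t) (verticesL (off + length (vertices off t)) ts) w
    ... | w₁ , w₂ with j <? length (vertices off t)
    ... | yes j<ℓₜ with vertex-subtree off t w₁ j j<ℓₜ
    ...   | S , S⊑t , info = S , t , here refl , S⊑t , info
    vertex-subtrees off (t ∷ ts) w j j< | w₁ , w₂ | no j≮ℓₜ
      with vertex-subtrees (off + length (vertices off t)) ts w₂ (j ∸ length (vertices off t)) j-ℓₜ<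
      where
      j-ℓₜ< : j ∸ length (vertices off t) < length (verticesL (off + length (vertices off t)) ts)
      j-ℓₜ< = ≡.subst (j ∸ length (vertices off t) <_) (ℕP.m+n∸m≡n (length (vertices off t)) _)
                (ℕP.∸-monoˡ-< (≡.subst (j <_) (ListP.length-++ (vertices off t)) j<) (ℕP.≮⇒≥ j≮ℓₜ))
    ... | S , t′ , t′∈ts , S⊑t′ , info =
      S , t′ , there t′∈ts , S⊑t′ , ≡.subst (λ x → Represents x S × VertexInfo x S) index info
      where
      index : off + length (vertices off t) + (j ∸ length (vertices off t)) ≡ off + j
      index = trans (ℕP.+-assoc off _ _) (cong (off +_) (ℕP.m+[n∸m]≡n (ℕP.≮⇒≥ j≮ℓₜ)))

  vertex : ∀ (i : Fin N) → ∃ λ S → S ⊑ T × Represents (suc (toℕ i)) S × VertexInfo (suc (toℕ i)) S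
  vertex i = vertex-subtree 1 T window-V (toℕ i) (FinP.toℕ<n i)

  childCount-vertexAt : ∀ vs j → length (proj₂ (vertexAt vs j)) ≤ childCount vs
  childCount-vertexAt [] j = z≤n
  childCount-vertexAt ((m , cs) ∷ vs) zero = ℕP.m≤m+n _ _
  childCount-vertexAt ((m , cs) ∷ vs) (suc j) = ℕP.≤-trans (childCount-vertexAt vs j) (ℕP.m≤n+m _ _)

  H-homogeneous : ∀ i → All (λ t → length (wordOf t) ≡ d) (H i)
  H-homogeneous Fin.zero = []
  H-homogeneous (Fin.suc i) = trans (ListP.length-++ (replicate (d ∸ length cs) 0))
    (trans (cong (_+ length cs) (ListP.length-replicate (d ∸ length cs)))
      (ℕP.m∸n+n≡m (ℕP.≤-trans (childCount-vertexAt V (toℕ i)) (ℕP.m≤n+m _ α)))) ∷ []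
    where
    cs : List ℕ
    cs = proj₂ (vertexAt V (toℕ i))

  H-triangular : ∀ i → VarsBelow (toℕ i) (H i)
  H-triangular Fin.zero = []
  H-triangular (Fin.suc i) with vertex i
  ... | _ , _ , _ , cs , at≡ , cs<i rewrite at≡ = AllP.++⁺ (AllP.replicate⁺ _ (s≤s z≤n)) cs<i ∷ []

  H-labels : ∀ {W} → LabelsIn W T → ∀ i → All (λ t → W (proj₁ (key t))) (H i)
  H-labels lT Fin.zero = []
  H-labels lT (Fin.suc i) with vertex i
  ... | node _ _ , S⊑T , _ , _ , at≡ , _ rewrite at≡ with ⊑-LabelsIn S⊑T lT
  ...   | node Wm _ = Wm ∷ []

  UnitTerms-H : ∀ i → UnitTerms (H i)
  UnitTerms-H Fin.zero = []
  UnitTerms-H (Fin.suc i) = ≈-refl ∷ []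

  P-vanishes : Positive T → ∀ T′ → weight T ≤ weight T′ → ¬ T′ ≅ T → ∀ i → P n H T′ i ≡ []
  P-vanishes posT T′ ≤w T′≇T Fin.zero = P-zero T′
  P-vanishes posT T′ ≤w T′≇T (Fin.suc i) with P n H T′ (Fin.suc i) in P≡ | vertex i
  ... | [] | _ = refl
  ... | _ ∷ _ | S , S⊑T , S-rep , _ = ⊥-elim (case ⊑⇒≡⊎< posT S⊑T of λ where
          (inj₁ refl) → T′≇T (↪-tight⇒≅ T′↪S posT ≤w)
          (inj₂ S<T) → ℕP.<⇒≱ S<T (ℕP.≤-trans ≤w (↪-weight T′↪S)))
    where
    x<n : suc (toℕ i) < n
    x<n = s≤s (FinP.toℕ<n i)
    P≢[] : P n H T′ (fromℕ< x<n) ≢ []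
    P≢[] rewrite FinP.fromℕ<-toℕ (Fin.suc i) x<n | P≡ = λ ()
    T′↪S : T′ ↪ S
    T′↪S = NonzeroAt⇒↪ T′ S-rep (P≢[]⇒NonzeroAt {T′} x<n P≢[])

  P-nonzero : ∀ (f : ℚ.ℚ → Carrier) → RingMorphisms.IsRingHomomorphism ℚP.+-*-rawRing rawRing f →
              ¬ 1# ≈ 0# → ¬ (∀ i → IsZero (P n H T i))
  P-nonzero f f-hom 1≉0 P≈0 with Represents⇒NonzeroAt (represents-root 1 T window-V)
  ... | nz with ∃-∈ (NonzeroAt⇒P≢[] {T} (NonzeroAt-< {T} {rootIndex 1 T} nz) nz)
  ... | t@(_ , (_ , _)) , t∈ = UnitTerms-∈⇒coeff≉0 f f-hom 1≉0 _ (UnitTerms-P n H UnitTerms-H T _) t∈ (P≈0 _ _ _)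

lemma5p4 : ∀ {c ℓ} (K : CommutativeRing c ℓ) → IsℚAlgebra K →
    ¬ (CommutativeRing._≈_ K (CommutativeRing.1# K) (CommutativeRing.0# K)) →
    (b : Bool) (α : ℕ) → 1 ≤ α →
    (W : ℕ → Set) → Σ ℕ W → (∀ m → W m → 1 ≤ m) →
    (T : Tree) → LabelsIn W T →
    Σ ℕ λ n → 1 ≤ n × Σ (Fin n → Poly.Pol K b) λ H →
      Poly.InB K b n α H ×
      (∀ i a u → ¬ W a → CommutativeRing._≈_ K (Poly.coeff K b (H i) a u) (CommutativeRing.0# K)) ×
      ¬ (∀ i → Poly.IsZero K b (Poly.P K b n H T i)) ×
      (∀ T′ → LabelsIn W T′ → weight T ≤ weight T′ → ¬ (T′ ≅ T) →
        ∀ i → Poly.IsZero K b (Poly.P K b n H T′ i))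
lemma5p4 K (f , f-hom) 1≉0 b α _ W _ W⇒1≤ T lT =
  n , s≤s z≤n , H ,
  triangular⇒InB α d (ℕP.m≤m+n α _) H-terms ,
  (λ i a u → coeff-outside (H i) (H-labels lT i) a u) ,
  P-nonzero f f-hom 1≉0 ,
  λ T′ _ ≤w T′≇T i → ≡.subst (Poly.IsZero K b) (≡.sym (P-vanishes posT T′ ≤w T′≇T i)) (λ _ _ → CommutativeRing.refl K)
  where
  open Construction K b α T
  open TriangularAutomorphism K b n H H-triangular using (triangular⇒InB)
  open Coefficients K b using (coeff-outside; wordOf)
  open TreeEmbedding using (Positive; LabelsIn⇒Positive)

  H-terms : ∀ i → All (λ t → 1 ≤ proj₁ (proj₂ t) × length (wordOf t) ≡ d) (H i)
  H-terms i = All.zipWith (λ (Wm , ≡d) → W⇒1≤ _ Wm , ≡d) (H-labels lT i , H-homogeneous i)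

  posT : Positive T
  posT = LabelsIn⇒Positive W⇒1≤ lT
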